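{- Let $n\ge2$, $1\le r\le n$, and write $\mathrm{st}^r_n(q)=\sum_{\alpha\models n}c^r_\alpha(q)M_\alpha$. Then for every composition $\alpha=(\alpha_1,\dots,\alpha_\ell)$ of $n$, $$c^r_\alpha(q)=\sum_{i:\ \alpha_i=1}\mathrm{mult}(\mathrm{rcomp}(\alpha,i))\,\mathrm{mult}(\mathrm{lcomp}(\alpha,i))\sum_{j=0}^{\min\{L^{n-r}_{\alpha_i},R^{r-1}_{\alpha_i}\}}\binom{n-r}{L^{n-r}_{\alpha_i}-j}\binom{r-1}{R^{r-1}_{\alpha_i}-j}q^{2j+|n-r-L_{\alpha_i}|}.$$
   Context: The star graph $\mathrm{St}_n$ has $n$ vertices, a root $v_0$, and edges exactly $\{v_0,v\}$ for $v\ne v_0$. A labeling is a bijection $L:V\to\{1,\dots,n\}$; a proper coloring is $\kappa:V\to\mathbb{Z}_{>0}$ with adjacent vertices colored differently; $\mathrm{asc}^L(\kappa)$ counts edges $\{u,v\}$ with $L(u)<L(v)$ and $\kappa(u)<\kappa(v)$; $\chi^L_G(x;q)=\sum_\kappa q^{\mathrm{asc}^L(\kappa)}x^\kappa$ with $x^\kappa=\prod_j x_j^{\#\kappa^{ -1}(j)}$. $\mathrm{st}^r_n(q)=\chi^L_{\mathrm{St}_n}(x;q)$ for any labeling $L$ with $L(v_0)=r$ (independent of this choice). $M_\alpha=\sum_{i_1<\dots<i_\ell}x_{i_1}^{\alpha_1}\cdots x_{i_\ell}^{\alpha_\ell}$. Notation: $\mathrm{lcomp}(\alpha,i)=(\alpha_1,\dots,\alpha_{i-1})$,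 $\mathrm{rcomp}(\alpha,i)=(\alpha_{i+1},\dots,\alpha_\ell)$, $L_{\alpha_i}=\alpha_1+\dots+\alpha_{i-1}$, $R_{\alpha_i}=\alpha_{i+1}+\dots+\alpha_\ell$, $L^m_{\alpha_i}=\min\{m,L_{\alpha_i}\}$, $R^m_{\alpha_i}=\min\{m,R_{\alpha_i}\}$, $\mathrm{mult}(\beta)=\frac{|\beta|!}{\prod_m\beta_m!}$ with $\mathrm{mult}(\emptyset)=1$. -}

module Defs where

open import Data.Bool using (Bool; true; false; _∧_; _∨_; if_then_else_)
open import Data.Nat using (ℕ; zero; suc; _+_; _*_; _∸_; _⊓_; _!; ∣_-_∣; NonZero; _≟_; _<?_)
open import Data.Nat.Properties using (_!≢0; m*n≢0)
open import Data.Nat.DivMod using (_/_)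
open import Data.Nat.Combinatorics using (_C_)
open import Data.Fin using (Fin; toℕ) renaming (zero to fzero; suc to fsuc; _≟_ to _≟ᶠ_)
open import Data.List.Base using (List; []; _∷_; [_]; map; concatMap; allFin; take; drop; length; lookup; upTo; all)
open import Data.Nat.ListAction using (sum; product)
open import Function.Bundles using (_↔_; Inverse)
open import Relation.Nullary.Decidable using (⌊_⌋; ¬?)

countB : {A : Set} → List A → (A → Bool) → ℕ
countB xs p = sum (map (λ x → if p x then 1 else 0) xs)

ΣFin : (n : ℕ) → (Fin n → ℕ) → ℕ
ΣFin n f = sum (map f (allFin n))

allFuns : (n B : ℕ) → List (Fin n → Fin B)
allFuns zero    B = [ (λ ()) ]
allFuns (suc n) B =
  concatMap (λ f → map (λ c → cons c f) (allFin B)) (allFuns n B)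
  where
  cons : Fin B → (Fin n → Fin B) → Fin (suc n) → Fin B
  cons c f fzero    = c
  cons c f (fsuc i) = f i

-- The star graph St_n on vertex set Fin n with root v0:
-- edges are exactly {v0, v} for v ≠ v0.
-- A labeling is a bijection L : Fin n ↔ Fin n (label of v is 1 + toℕ (L v)).
-- A coloring with colours in {0,…,B-1} is κ : Fin n → Fin B
-- (colour c corresponds to the variable x_{c}).

module Star (n : ℕ) (v0 : Fin n) (L : Fin n ↔ Fin n) where

  lab : Fin n → ℕ
  lab v = toℕ (Inverse.to L v)

  isEdgeTo : Fin n → Bool
  isEdgeTo v = ⌊ ¬? (v ≟ᶠ v0) ⌋

  module _ {B : ℕ} (κ : Fin n → Fin B) where

    col : Fin n → ℕ
    col v = toℕ (κ v)

    proper : Bool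
    proper = all (λ v → (if isEdgeTo v then ⌊ ¬? (col v ≟ col v0) ⌋ else true)) (allFin n)

    ascentAt : Fin n → Bool
    ascentAt v = isEdgeTo v ∧
      ((⌊ lab v0 <? lab v ⌋ ∧ ⌊ col v0 <? col v ⌋) ∨
       (⌊ lab v <? lab v0 ⌋ ∧ ⌊ col v <? col v0 ⌋))

    asc : ℕ
    asc = countB (allFin n) ascentAt

    fibre : Fin B → ℕ
    fibre c = countB (allFin n) (λ v → ⌊ κ v ≟ᶠ c ⌋)

    -- x^κ = x^e  (exponent of x_c is e c for every c < B)
    hasContent : (Fin B → ℕ) → Bool
    hasContent e = all (λ c → ⌊ fibre c ≟ e c ⌋) (allFin B)

  -- Coefficient of  q^k x^e  in  χ^L_{St_n}(x;q) = Σ_κ q^{asc^L(κ)} x^κ,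
  -- for an exponent vector e supported on the colours {0,…,B-1}
  -- (any proper colouring κ with x^κ = x^e takes values < B).
  chiCoeff : (B : ℕ) → (Fin B → ℕ) → ℕ → ℕ
  chiCoeff B e k = countB (allFuns n B)
    (λ κ → proper κ ∧ hasContent κ e ∧ ⌊ asc κ ≟ k ⌋)

prod!≢0 : (β : List ℕ) → NonZero (product (map _! β))
prod!≢0 []      = _
prod!≢0 (b ∷ β) = m*n≢0 (b !) (product (map _! β)) {{b !≢0}} {{prod!≢0 β}}

mult : List ℕ → ℕ
mult β = (sum β ! / product (map _! β)) {{prod!≢0 β}}

module Formula (n r : ℕ) (α : List ℕ) where

  lcomp rcomp : Fin (length α) → List ℕ
  lcomp i = take (toℕ i) α
  rcomp i = drop (suc (toℕ i)) α

  Lα Rα Lm Rm : Fin (length α) → ℕ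
  Lα i = sum (lcomp i)
  Rα i = sum (rcomp i)
  Lm i = (n ∸ r) ⊓ Lα i
  Rm i = (r ∸ 1) ⊓ Rα i

  innerCoeff : Fin (length α) → ℕ → ℕ
  innerCoeff i k = sum (map
    (λ j → if ⌊ 2 * j + ∣ (n ∸ r) - Lα i ∣ ≟ k ⌋
             then ((n ∸ r) C (Lm i ∸ j)) * ((r ∸ 1) C (Rm i ∸ j))
             else 0)
    (upTo (suc (Lm i ⊓ Rm i))))

  rhsCoeff : ℕ → ℕ
  rhsCoeff k = ΣFin (length α) (λ i →
    if ⌊ lookup α i ≟ 1 ⌋
      then mult (rcomp i) * mult (lcomp i) * innerCoeff i k
      else 0)

{-# OPTIONS --safe #-}
module Submission where

-- A colouring contributes only if the root v₀ gets a colour c₀ used exactly once; every leaf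
-- then gets a colour below or above c₀, and it is an ascent exactly when it is "big" (label
-- above the root's) and coloured above c₀, or "small" and coloured below c₀. For c₀ = idx i a
-- colouring is thus a choice of the set of low leaves together with a word in the colours
-- below c₀ of content lcomp(α,i) and one in the colours above c₀ of content rcomp(α,i); the
-- words are counted by multinomial coefficients. If a of the L = L_{α_i} low leaves are big,
-- there are (n-r-a) + (L-a) ascents, so k determines a and the low leaves are counted by a
-- single product of binomial coefficients, the only nonzero term of the paper's sum over j.

open import Defs
open import Algebra.Bundles using (CommutativeMonoid)
open import Algebra.Structures using (IsCommutativeMonoid)
open import Data.Bool using (Bool; true; false; _∧_; if_then_else_)
open import Data.Bool.ListAction using (and)
open import Data.Bool.Properties
  using (∧-commutativeMonoid; ∧-isCommutativeMonoid; if-∧; ∧-zeroʳ; ∨-identityʳ)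
open import Data.Empty using (⊥-elim)
open import Data.Fin using (Fin; toℕ; fromℕ<) renaming (_<_ to _<ᶠ_; zero to fzero; suc to fsuc)
open import Data.Fin.Properties using (toℕ-injective; toℕ-fromℕ<; toℕ<n; any?)
  renaming (_≟_ to _≟ᶠ_; suc-injective to fsuc-injective)
open import Data.List.Base
  using (List; []; _∷_; _++_; length; lookup; map; foldr; take; drop; concatMap; allFin; tabulate; applyUpTo; upTo)
open import Data.List.Properties using (map-++; map-cong; map-∘; map-id)
open import Data.List.Relation.Unary.All using (All)
open import Data.Nat
  using (ℕ; zero; suc; _+_; _*_; _∸_; _!; _⊓_; ∣_-_∣; _≤_; _<_; _<?_; _≤?_; s<s; s<s⁻¹; z≤n; s≤s)
  renaming (_≟_ to _≟ℕ_)
open import Data.Nat.Combinatorics using (_C_; k>n⇒nCk≡0; nCk+nC[k+1]≡[n+1]C[k+1]; nCk≡nC[n∸k])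
open import Data.Nat.DivMod using (_/_; m*n/n≡m)
open import Data.Nat.ListAction using (sum; product)
open import Data.Nat.ListAction.Properties using (sum-++)
open import Data.Nat.Properties
open import Data.Nat.Tactic.RingSolver using (solve-∀)
open import Data.Product using (∃-syntax; _,_)
open import Data.Vec.Functional using () renaming (_∷_ to _∷ᵛ_)
open import Function.Base using (_∘_)
open import Function.Bundles using (_↔_; Inverse; mk⇔)
open import Relation.Binary.Definitions using (tri<; tri≈; tri>)
open import Relation.Binary.PropositionalEquality
  using (_≡_; _≢_; refl; sym; trans; cong; cong₂; subst; subst₂; ≢-sym; module ≡-Reasoning)
open import Relation.Nullary using (Dec; yes; no; ¬_)
open import Relation.Nullary.Decidable using (⌊_⌋; ¬?; isYes≗does; dec-true; dec-false; does-⇔)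
open import Algebra.Properties.CommutativeSemigroup *-commutativeSemigroup
  using () renaming (x∙yz≈y∙xz to x*[y*z]≡y*[x*z])
open import Algebra.Solver.CommutativeMonoid ∧-commutativeMonoid using (solve; _⊕_; _⊜_)

open ≡-Reasoning

true≢false : true ≢ false
true≢false ()

[_] : Bool → ℕ
[ b ] = if b then 1 else 0

if-then-0 : ∀ b x → (if b then x else 0) ≡ [ b ] * x
if-then-0 true  x = sym (+-identityʳ x)
if-then-0 false x = refl

⌊⌋-true : ∀ {a} {A : Set a} (x : Dec A) → A → ⌊ x ⌋ ≡ true
⌊⌋-true x a = trans (isYes≗does x) (dec-true x a)

⌊⌋-false : ∀ {a} {A : Set a} (x : Dec A) → ¬ A → ⌊ x ⌋ ≡ false
⌊⌋-false x ¬a = trans (isYes≗does x) (dec-false x ¬a)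

⌊⌋-⇔ : ∀ {a b} {A : Set a} {B : Set b} (x : Dec A) (y : Dec B) → (A → B) → (B → A) → ⌊ x ⌋ ≡ ⌊ y ⌋
⌊⌋-⇔ x y f g = trans (isYes≗does x) (trans (does-⇔ (mk⇔ f g) x y) (sym (isYes≗does y)))

⌊≟ᶠ⌋-refl : ∀ {B} (c : Fin B) → ⌊ c ≟ᶠ c ⌋ ≡ true
⌊≟ᶠ⌋-refl c = ⌊⌋-true (c ≟ᶠ c) refl

⌊suc≟suc⌋ : ∀ a b → ⌊ suc a ≟ℕ suc b ⌋ ≡ ⌊ a ≟ℕ b ⌋
⌊suc≟suc⌋ a b = ⌊⌋-⇔ (suc a ≟ℕ suc b) (a ≟ℕ b) suc-injective (cong suc)

⌊suc≤?suc⌋ : ∀ a b → ⌊ suc a ≤? suc b ⌋ ≡ ⌊ a ≤? b ⌋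
⌊suc≤?suc⌋ a b = ⌊⌋-⇔ (suc a ≤? suc b) (a ≤? b) ≤-pred s≤s

⌊suc<?suc⌋ : ∀ a b → ⌊ suc a <? suc b ⌋ ≡ ⌊ a <? b ⌋
⌊suc<?suc⌋ a b = ⌊⌋-⇔ (suc a <? suc b) (a <? b) s<s⁻¹ s<s

+-≟-split : ∀ a x y → ⌊ a + x ≟ℕ y ⌋ ≡ ⌊ a ≤? y ⌋ ∧ ⌊ x ≟ℕ y ∸ a ⌋
+-≟-split a x y with a ≤? y
... | yes a≤y = ⌊⌋-⇔ (a + x ≟ℕ y) (x ≟ℕ y ∸ a)
                  (λ a+x≡y → trans (sym (m+n∸m≡n a x)) (cong (_∸ a) a+x≡y))
                  (λ x≡y∸a → trans (cong (a +_) x≡y∸a) (m+[n∸m]≡n a≤y))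
... | no a≰y  = ⌊⌋-false (a + x ≟ℕ y) (λ a+x≡y → a≰y (subst (a ≤_) a+x≡y (m≤m+n a x)))

module FinFold {A : Set} {_∙_ : A → A → A} {ε : A} (isCM : IsCommutativeMonoid _≡_ _∙_ ε) where

  private
    M : CommutativeMonoid _ _
    M = record { Carrier = A ; _≈_ = _≡_ ; _∙_ = _∙_ ; ε = ε ; isCommutativeMonoid = isCM }
    open IsCommutativeMonoid isCM using (identityˡ; identityʳ)

  open import Algebra.Properties.CommutativeMonoid.Sum M public
    using (∑-comm; ∑-distrib-+; sum-cong-≗; sum-replicate-zero) renaming (sum to fold)

  fold-delta : ∀ {m} (j : Fin m) (g : Fin m → A) → fold (λ i → if ⌊ j ≟ᶠ i ⌋ then g i else ε) ≡ g j
  fold-delta {suc m} fzero    g = trans (cong (g fzero ∙_) (sum-replicate-zero m)) (identityʳ _)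
  fold-delta {suc m} (fsuc j) g =
    trans (identityˡ _) (trans (sum-cong-≗ shift) (fold-delta j (λ i → g (fsuc i))))
    where
    shift : ∀ i → (if ⌊ fsuc j ≟ᶠ fsuc i ⌋ then g (fsuc i) else ε) ≡ (if ⌊ j ≟ᶠ i ⌋ then g (fsuc i) else ε)
    shift i = cong (if_then g (fsuc i) else ε) (⌊⌋-⇔ (fsuc j ≟ᶠ fsuc i) (j ≟ᶠ i) fsuc-injective (cong fsuc))

  fold-extract : ∀ {m} (c : Fin m) x (f g : Fin m → A) →
                 (∀ i → f i ≡ g i ∙ (if ⌊ c ≟ᶠ i ⌋ then x else ε)) → fold f ≡ fold g ∙ x
  fold-extract c x f g f≡ = begin
    fold f                                              ≡⟨ sum-cong-≗ f≡ ⟩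
    fold (λ i → g i ∙ (if ⌊ c ≟ᶠ i ⌋ then x else ε))   ≡⟨ ∑-distrib-+ g _ ⟩
    fold g ∙ fold (λ i → if ⌊ c ≟ᶠ i ⌋ then x else ε)  ≡⟨ cong (fold g ∙_) (fold-delta c (λ _ → x)) ⟩
    fold g ∙ x                                          ∎

  fold-reindex : ∀ {B ℓ} (idx : Fin ℓ → Fin B) → (∀ {i j} → idx i ≡ idx j → i ≡ j) →
                 (f : Fin B → A) → (∀ c → (∀ j → idx j ≢ c) → f c ≡ ε) → fold f ≡ fold (λ j → f (idx j))
  fold-reindex {B} {ℓ} idx idx-injective f off = begin
    fold f                                                       ≡⟨ sum-cong-≗ spread ⟩
    fold (λ c → fold (λ j → if ⌊ idx j ≟ᶠ c ⌋ then f c else ε))  ≡⟨ ∑-comm δ ⟩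
    fold (λ j → fold (λ c → if ⌊ idx j ≟ᶠ c ⌋ then f c else ε))  ≡⟨ sum-cong-≗ (λ j → fold-delta (idx j) f) ⟩
    fold (λ j → f (idx j))                                       ∎
    where
    δ : Fin B → Fin ℓ → A
    δ c j = if ⌊ idx j ≟ᶠ c ⌋ then f c else ε
    spread : ∀ c → f c ≡ fold (δ c)
    spread c with any? (λ j → idx j ≟ᶠ c)
    ... | yes (j₀ , idx-j₀≡c) = sym (trans (sum-cong-≗ only-j₀) (fold-delta j₀ (λ _ → f c)))
      where
      only-j₀ : ∀ j → δ c j ≡ (if ⌊ j₀ ≟ᶠ j ⌋ then f c else ε)
      only-j₀ j = cong (if_then f c else ε)
        (⌊⌋-⇔ (idx j ≟ᶠ c) (j₀ ≟ᶠ j) (λ idx-j≡c → idx-injective (trans idx-j₀≡c (sym idx-j≡c)))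
                                    (λ { refl → idx-j₀≡c }))
    ... | no ∄j = trans (off c (λ j idx-j≡c → ∄j (j , idx-j≡c)))
                        (sym (trans (sum-cong-≗ none) (sum-replicate-zero ℓ)))
      where
      none : ∀ j → δ c j ≡ ε
      none j = cong (if_then f c else ε) (⌊⌋-false (idx j ≟ᶠ c) (λ idx-j≡c → ∄j (j , idx-j≡c)))

  fold-lookup : (α : List ℕ) (g : ℕ → A) → fold (λ j → g (lookup α j)) ≡ foldr _∙_ ε (map g α)
  fold-lookup []      g = refl
  fold-lookup (a ∷ α) g = cong (g a ∙_) (fold-lookup α g)

  fold-take : (α : List ℕ) (i : Fin (length α)) (g : ℕ → A) →
              fold (λ j → if ⌊ toℕ j <? toℕ i ⌋ then g (lookup α j) else ε) ≡ foldr _∙_ ε (map g (take (toℕ i) α))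
  fold-take (a ∷ α) fzero    g = trans (identityˡ _) (sum-replicate-zero (length α))
  fold-take (a ∷ α) (fsuc i) g = cong (g a ∙_) (trans (sum-cong-≗ shift) (fold-take α i g))
    where
    shift : ∀ j → (if ⌊ suc (toℕ j) <? suc (toℕ i) ⌋ then g (lookup α j) else ε)
                ≡ (if ⌊ toℕ j <? toℕ i ⌋ then g (lookup α j) else ε)
    shift j = cong (if_then g (lookup α j) else ε) (⌊suc<?suc⌋ (toℕ j) (toℕ i))

  fold-drop : (α : List ℕ) (i : Fin (length α)) (g : ℕ → A) →
              fold (λ j → if ⌊ toℕ i <? toℕ j ⌋ then g (lookup α j) else ε)
              ≡ foldr _∙_ ε (map g (drop (suc (toℕ i)) α))
  fold-drop (a ∷ α) fzero    g = trans (identityˡ _) (fold-lookup α g)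
  fold-drop (a ∷ α) (fsuc i) g = trans (identityˡ _) (trans (sum-cong-≗ shift) (fold-drop α i g))
    where
    shift : ∀ j → (if ⌊ suc (toℕ i) <? suc (toℕ j) ⌋ then g (lookup α j) else ε)
                ≡ (if ⌊ toℕ i <? toℕ j ⌋ then g (lookup α j) else ε)
    shift j = cong (if_then g (lookup α j) else ε) (⌊suc<?suc⌋ (toℕ i) (toℕ j))

  module Supported (α : List ℕ) {B} (idx : Fin (length α) → Fin B)
                   (idx-injective : ∀ {i j} → idx i ≡ idx j → i ≡ j)
                   (idx-< : ∀ i j → ⌊ toℕ (idx i) <? toℕ (idx j) ⌋ ≡ ⌊ toℕ i <? toℕ j ⌋)
                   (e : Fin B → ℕ) (e∘idx : ∀ j → e (idx j) ≡ lookup α j)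
                   (e-off : ∀ c → (∀ j → idx j ≢ c) → e c ≡ 0)
                   (g : ℕ → A) (g0≡ε : g 0 ≡ ε) where

    private
      vanishes-off : ∀ (p : Fin B → Bool) c → (∀ j → idx j ≢ c) → (if p c then g (e c) else ε) ≡ ε
      vanishes-off p c off with p c
      ... | true  = trans (cong g (e-off c off)) g0≡ε
      ... | false = refl

    fold-all : fold (λ c → g (e c)) ≡ foldr _∙_ ε (map g α)
    fold-all = trans (fold-reindex idx idx-injective (λ c → g (e c)) (λ c off → trans (cong g (e-off c off)) g0≡ε))
                     (trans (sum-cong-≗ (λ j → cong g (e∘idx j))) (fold-lookup α g))

    fold-before : ∀ i → fold (λ c → if ⌊ toℕ c <? toℕ (idx i) ⌋ then g (e c) else ε)
                        ≡ foldr _∙_ ε (map g (take (toℕ i) α))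
    fold-before i =
      trans (fold-reindex idx idx-injective _ (vanishes-off (λ c → ⌊ toℕ c <? toℕ (idx i) ⌋)))
            (trans (sum-cong-≗ (λ j → cong₂ (if_then_else ε) (idx-< j i) (cong g (e∘idx j)))) (fold-take α i g))

    fold-after : ∀ i → fold (λ c → if ⌊ toℕ (idx i) <? toℕ c ⌋ then g (e c) else ε)
                       ≡ foldr _∙_ ε (map g (drop (suc (toℕ i)) α))
    fold-after i =
      trans (fold-reindex idx idx-injective _ (vanishes-off (λ c → ⌊ toℕ (idx i) <? toℕ c ⌋)))
            (trans (sum-cong-≗ (λ j → cong₂ (if_then_else ε) (idx-< i j) (cong g (e∘idx j)))) (fold-drop α i g))

open import Algebra.Properties.Semiring.Sum +-*-semiring
  using (sum-syntax; ∑-distrib-+; ∑-permute; *-distribˡ-sum; *-distribʳ-sum; sum-replicate-zero)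
  renaming (sum-cong-≗ to ∑-cong)
open FinFold +-0-isCommutativeMonoid using ()
  renaming (fold-delta to ∑-delta; fold-extract to ∑-extract; fold-reindex to ∑-reindex)
open FinFold *-1-isCommutativeMonoid using ()
  renaming (fold to ∏; sum-cong-≗ to ∏-cong; sum-replicate-zero to ∏-one; fold-extract to ∏-extract)
open FinFold ∧-isCommutativeMonoid using ()
  renaming (fold to every; sum-cong-≗ to every-cong; ∑-distrib-+ to every-∧; fold-delta to every-delta)

term≤∑ : ∀ {m} (f : Fin m → ℕ) i → f i ≤ ∑[ j < m ] f j
term≤∑ f fzero    = m≤m+n _ _
term≤∑ f (fsuc i) = ≤-trans (term≤∑ (λ j → f (fsuc j)) i) (m≤n+m _ _)

every-false : ∀ {m} (p : Fin m → Bool) j → p j ≡ false → every p ≡ false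
every-false p fzero    pj≡false = cong (_∧ every (λ i → p (fsuc i))) pj≡false
every-false p (fsuc j) pj≡false =
  trans (cong (p fzero ∧_) (every-false (λ i → p (fsuc i)) j pj≡false)) (∧-zeroʳ (p fzero))

every-zero : ∀ {m} (e : Fin m → ℕ) → every (λ c → ⌊ 0 ≟ℕ e c ⌋) ≡ ⌊ ∑[ c < m ] e c ≟ℕ 0 ⌋
every-zero {zero}  e = refl
every-zero {suc m} e with e fzero
... | zero  = every-zero (λ c → e (fsuc c))
... | suc _ = refl

sum-map-tabulate : ∀ {A : Set} {m} (g : Fin m → A) (f : A → ℕ) → sum (map f (tabulate g)) ≡ ∑[ i < m ] f (g i)
sum-map-tabulate {m = zero}  g f = refl
sum-map-tabulate {m = suc m} g f = cong (f (g fzero) +_) (sum-map-tabulate (λ i → g (fsuc i)) f)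

sum-map-applyUpTo : ∀ N (h f : ℕ → ℕ) → sum (map f (applyUpTo h N)) ≡ ∑[ j < N ] f (h (toℕ j))
sum-map-applyUpTo zero    h f = refl
sum-map-applyUpTo (suc N) h f = cong (f (h 0) +_) (sum-map-applyUpTo N (λ x → h (suc x)) f)

countB-allFin : ∀ {m} (p : Fin m → Bool) → countB (allFin m) p ≡ ∑[ i < m ] [ p i ]
countB-allFin p = sum-map-tabulate (λ i → i) (λ i → [ p i ])

and-map-tabulate : ∀ {A : Set} {m} (g : Fin m → A) (p : A → Bool) → and (map p (tabulate g)) ≡ every (λ i → p (g i))
and-map-tabulate {m = zero}  g p = refl
and-map-tabulate {m = suc m} g p = cong (p (g fzero) ∧_) (and-map-tabulate (λ i → g (fsuc i)) p)

sum-map-∑ : ∀ {A : Set} {B} (g : A → Fin B → ℕ) (xs : List A) →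
            sum (map (λ x → ∑[ c < B ] g x c) xs) ≡ ∑[ c < B ] sum (map (λ x → g x c) xs)
sum-map-∑ {B = B} g []       = sym (sum-replicate-zero B)
sum-map-∑ {B = B} g (x ∷ xs) =
  trans (cong (∑[ c < B ] g x c +_) (sum-map-∑ g xs)) (sym (∑-distrib-+ (g x) (λ c → sum (map (λ x → g x c) xs))))

sum-map-if : ∀ {A : Set} b (f : A → ℕ) xs → sum (map (λ x → if b then f x else 0) xs) ≡ (if b then sum (map f xs) else 0)
sum-map-if true  f xs       = refl
sum-map-if false f []       = refl
sum-map-if false f (x ∷ xs) = sum-map-if false f xs

sum-map-concatMap : ∀ {A C : Set} (f : C → ℕ) (g : A → List C) xs →
                    sum (map f (concatMap g xs)) ≡ sum (map (λ x → sum (map f (g x))) xs)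
sum-map-concatMap f g []       = refl
sum-map-concatMap f g (x ∷ xs) = begin
  sum (map f (g x ++ concatMap g xs))                         ≡⟨ cong sum (map-++ f (g x) _) ⟩
  sum (map f (g x) ++ map f (concatMap g xs))                 ≡⟨ sum-++ (map f (g x)) _ ⟩
  sum (map f (g x)) + sum (map f (concatMap g xs))            ≡⟨ cong (sum (map f (g x)) +_) (sum-map-concatMap f g xs) ⟩
  sum (map f (g x)) + sum (map (λ x → sum (map f (g x))) xs)  ∎

sum-allFuns-suc : ∀ {m B} (F : (Fin (suc m) → Fin B) → ℕ) (G : Fin B → (Fin m → Fin B) → ℕ) →
                  (∀ κ → F κ ≡ G (κ fzero) (λ v → κ (fsuc v))) →
                  sum (map F (allFuns (suc m) B)) ≡ sum (map (λ κ → ∑[ c < B ] G c κ) (allFuns m B))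
sum-allFuns-suc {m} {B} F G F≡G =
  trans (sum-map-concatMap F _ (allFuns m B)) (cong sum (map-cong (λ κ → by-first-colour _) (allFuns m B)))
  where
  by-first-colour : (h : Fin B → Fin (suc m) → Fin B) →
                    sum (map F (map h (allFin B))) ≡ ∑[ c < B ] G (h c fzero) (λ v → h c (fsuc v))
  by-first-colour h = trans (cong sum (sym (map-∘ (allFin B))))
                            (trans (sum-map-tabulate (λ c → c) (λ c → F (h c))) (∑-cong λ c → F≡G (h c)))

content : ∀ {m B} → (Fin m → Fin B) → Fin B → ℕ
content {m} κ c = ∑[ v < m ] [ ⌊ κ v ≟ᶠ c ⌋ ]

_⊖_ : ∀ {B} → (Fin B → ℕ) → Fin B → Fin B → ℕ
(e ⊖ c) c′ = if ⌊ c ≟ᶠ c′ ⌋ then e c′ ∸ 1 else e c′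

⊖-self : ∀ {B} (e : Fin B → ℕ) c → (e ⊖ c) c ≡ e c ∸ 1
⊖-self e c = cong (if_then e c ∸ 1 else e c) (⌊≟ᶠ⌋-refl c)

⊖-other : ∀ {B} (e : Fin B → ℕ) {c c′} → c ≢ c′ → (e ⊖ c) c′ ≡ e c′
⊖-other e {c} {c′} c≢c′ = cong (if_then e c′ ∸ 1 else e c′) (⌊⌋-false (c ≟ᶠ c′) c≢c′)

admissible : ∀ {m B} → (Fin m → Fin B → Bool) → (Fin m → Fin B → ℕ) → (Fin B → ℕ) → ℕ →
             (Fin m → Fin B) → Bool
admissible {m} ok wt e k κ =
  every (λ v → ok v (κ v)) ∧ every (λ c → ⌊ content κ c ≟ℕ e c ⌋) ∧ ⌊ ∑[ v < m ] wt v (κ v) ≟ℕ k ⌋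

count : ∀ m {B} → (Fin m → Fin B → Bool) → (Fin m → Fin B → ℕ) → (Fin B → ℕ) → ℕ → ℕ
count m {B} ok wt e k = countB (allFuns m B) (admissible ok wt e k)

admits : ∀ {B} → (Fin B → Bool) → (Fin B → ℕ) → (Fin B → ℕ) → ℕ → Fin B → Bool
admits ok wt e k c = ok c ∧ ⌊ 1 ≤? e c ⌋ ∧ ⌊ wt c ≤? k ⌋

every-content-suc : ∀ {m B} (c : Fin B) (κ : Fin m → Fin B) (e : Fin B → ℕ) →
  every (λ c′ → ⌊ [ ⌊ c ≟ᶠ c′ ⌋ ] + content κ c′ ≟ℕ e c′ ⌋)
  ≡ ⌊ 1 ≤? e c ⌋ ∧ every (λ c′ → ⌊ content κ c′ ≟ℕ (e ⊖ c) c′ ⌋)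
every-content-suc {B = B} c κ e = begin
  every (λ c′ → ⌊ [ ⌊ c ≟ᶠ c′ ⌋ ] + content κ c′ ≟ℕ e c′ ⌋)
    ≡⟨ every-cong (λ c′ → split ⌊ c ≟ᶠ c′ ⌋ (content κ c′) (e c′)) ⟩
  every (λ c′ → at-c c′ ∧ rest c′)  ≡⟨ every-∧ at-c rest ⟩
  every at-c ∧ every rest           ≡⟨ cong (_∧ every rest) (every-delta c (λ c′ → ⌊ 1 ≤? e c′ ⌋)) ⟩
  ⌊ 1 ≤? e c ⌋ ∧ every rest         ∎
  where
  split : ∀ b x y → ⌊ [ b ] + x ≟ℕ y ⌋ ≡ (if b then ⌊ 1 ≤? y ⌋ else true) ∧ ⌊ x ≟ℕ (if b then y ∸ 1 else y) ⌋
  split true  x y = +-≟-split 1 x y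
  split false x y = refl
  at-c rest : Fin B → Bool
  at-c c′ = if ⌊ c ≟ᶠ c′ ⌋ then ⌊ 1 ≤? e c′ ⌋ else true
  rest c′ = ⌊ content κ c′ ≟ℕ (e ⊖ c) c′ ⌋

admissible-suc : ∀ {m B} ok wt (e : Fin B → ℕ) k (κ : Fin (suc m) → Fin B) →
  admissible ok wt e k κ
  ≡ admits (ok fzero) (wt fzero) e k (κ fzero)
    ∧ admissible (λ v → ok (fsuc v)) (λ v → wt (fsuc v)) (e ⊖ κ fzero) (k ∸ wt fzero (κ fzero)) (λ v → κ (fsuc v))
admissible-suc {m} {B} ok wt e k κ =
  trans (cong₂ (λ X Y → (ok fzero c ∧ ok-rest) ∧ (X ∧ Y))
               (every-content-suc c (λ v → κ (fsuc v)) e) (+-≟-split (wt fzero c) weight-rest k))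
        (∧-shuffle (ok fzero c) ok-rest ⌊ 1 ≤? e c ⌋ content-rest ⌊ wt fzero c ≤? k ⌋ ⌊ weight-rest ≟ℕ k ∸ wt fzero c ⌋)
  where
  c : Fin B
  c = κ fzero
  ok-rest content-rest : Bool
  ok-rest      = every (λ v → ok (fsuc v) (κ (fsuc v)))
  content-rest = every (λ c′ → ⌊ content (λ v → κ (fsuc v)) c′ ≟ℕ (e ⊖ c) c′ ⌋)
  weight-rest : ℕ
  weight-rest = ∑[ v < m ] wt (fsuc v) (κ (fsuc v))
  ∧-shuffle : ∀ a b c d e f → (a ∧ b) ∧ ((c ∧ d) ∧ (e ∧ f)) ≡ (a ∧ c ∧ e) ∧ (b ∧ d ∧ f)
  ∧-shuffle = solve 6 (λ a b c d e f → (a ⊕ b) ⊕ ((c ⊕ d) ⊕ (e ⊕ f)) ⊜ (a ⊕ (c ⊕ e)) ⊕ (b ⊕ (d ⊕ f))) refl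

count-zero : ∀ {B} ok wt (e : Fin B → ℕ) k → count 0 ok wt e k ≡ [ every (λ c → ⌊ 0 ≟ℕ e c ⌋) ∧ ⌊ 0 ≟ℕ k ⌋ ]
count-zero ok wt e k = +-identityʳ _

count-suc : ∀ {m B} ok wt (e : Fin B → ℕ) k →
  count (suc m) ok wt e k
  ≡ ∑[ c < B ] (if admits (ok fzero) (wt fzero) e k c
                  then count m (λ v → ok (fsuc v)) (λ v → wt (fsuc v)) (e ⊖ c) (k ∸ wt fzero c) else 0)
count-suc {m} {B} ok wt e k = begin
  count (suc m) ok wt e k
    ≡⟨ sum-allFuns-suc _ step (λ κ → trans (cong [_] (admissible-suc ok wt e k κ)) (if-∧ (first (κ fzero)))) ⟩
  sum (map (λ κ → ∑[ c < B ] step c κ) (allFuns m B))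
    ≡⟨ sum-map-∑ (λ κ c → step c κ) (allFuns m B) ⟩
  ∑[ c < B ] sum (map (step c) (allFuns m B))
    ≡⟨ ∑-cong (λ c → sum-map-if (first c) _ (allFuns m B)) ⟩
  ∑[ c < B ] (if first c then count m ok′ wt′ (e ⊖ c) (k ∸ wt fzero c) else 0) ∎
  where
  ok′ : Fin m → Fin B → Bool
  ok′ v = ok (fsuc v)
  wt′ : Fin m → Fin B → ℕ
  wt′ v = wt (fsuc v)
  first : Fin B → Bool
  first = admits (ok fzero) (wt fzero) e k
  step : Fin B → (Fin m → Fin B) → ℕ
  step c κ = if first c then [ admissible ok′ wt′ (e ⊖ c) (k ∸ wt fzero c) κ ] else 0

total : ∀ {B} → (Fin B → Bool) → (Fin B → ℕ) → ℕ
total {B} p e = ∑[ c < B ] (if p c then e c else 0)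

-- Words of length s in the letters c with p c that use each such c exactly e c times,
-- counted by their first letter.
words : ∀ {B} → (Fin B → Bool) → ℕ → (Fin B → ℕ) → ℕ
words     p zero    e = [ ⌊ total p e ≟ℕ 0 ⌋ ]
words {B} p (suc s) e = ∑[ c < B ] (if p c ∧ ⌊ 1 ≤? e c ⌋ then words p s (e ⊖ c) else 0)

term≤total : ∀ {B} p (e : Fin B → ℕ) c → p c ≡ true → e c ≤ total p e
term≤total p e c pc = subst (λ b → (if b then e c else 0) ≤ total p e) pc (term≤∑ _ c)

total-⊖ : ∀ {B} p (e : Fin B → ℕ) c → total p e ≡ total p (e ⊖ c) + [ p c ∧ ⌊ 1 ≤? e c ⌋ ]
total-⊖ p e c = ∑-extract c _ _ _ split
  where
  at-c : (if p c then e c else 0) ≡ (if p c then e c ∸ 1 else 0) + [ p c ∧ ⌊ 1 ≤? e c ⌋ ]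
  at-c with p c | e c
  ... | false | _     = refl
  ... | true  | zero  = refl
  ... | true  | suc n = +-comm 1 n
  split : ∀ c′ → (if p c′ then e c′ else 0)
                 ≡ (if p c′ then (e ⊖ c) c′ else 0) + (if ⌊ c ≟ᶠ c′ ⌋ then [ p c ∧ ⌊ 1 ≤? e c ⌋ ] else 0)
  split c′ with c ≟ᶠ c′
  ... | yes refl = at-c
  ... | no _     = sym (+-identityʳ _)

total-⊖-outside : ∀ {B} p (e : Fin B → ℕ) c → p c ≡ false → total p (e ⊖ c) ≡ total p e
total-⊖-outside p e c pc = sym (begin
  total p e                                     ≡⟨ total-⊖ p e c ⟩
  total p (e ⊖ c) + [ p c ∧ ⌊ 1 ≤? e c ⌋ ]     ≡⟨ cong (λ b → total p (e ⊖ c) + [ b ∧ ⌊ 1 ≤? e c ⌋ ]) pc ⟩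
  total p (e ⊖ c) + 0                           ≡⟨ +-identityʳ _ ⟩
  total p (e ⊖ c)                               ∎)

total-⊖-inside : ∀ {B} p (e : Fin B → ℕ) c → p c ≡ true → 1 ≤ e c → total p (e ⊖ c) ≡ total p e ∸ 1
total-⊖-inside p e c pc 1≤ec = sym (begin
  total p e ∸ 1                                 ≡⟨ cong (_∸ 1) (total-⊖ p e c) ⟩
  total p (e ⊖ c) + [ p c ∧ ⌊ 1 ≤? e c ⌋ ] ∸ 1 ≡⟨ cong (λ b → total p (e ⊖ c) + [ b ] ∸ 1) p∧1≤ec ⟩
  total p (e ⊖ c) + 1 ∸ 1                       ≡⟨ m+n∸n≡m _ 1 ⟩
  total p (e ⊖ c)                               ∎)
  where
  p∧1≤ec : p c ∧ ⌊ 1 ≤? e c ⌋ ≡ true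
  p∧1≤ec = cong₂ _∧_ pc (⌊⌋-true (1 ≤? e c) 1≤ec)

words-cong : ∀ {B} p s (e e′ : Fin B → ℕ) → (∀ c → p c ≡ true → e c ≡ e′ c) → words p s e ≡ words p s e′
words-cong p zero    e e′ e≗e′ = cong (λ t → [ ⌊ t ≟ℕ 0 ⌋ ]) (∑-cong agree)
  where
  agree : ∀ c → (if p c then e c else 0) ≡ (if p c then e′ c else 0)
  agree c with p c in pc
  ... | true  = e≗e′ c pc
  ... | false = refl
words-cong p (suc s) e e′ e≗e′ = ∑-cong agree
  where
  agree : ∀ c → (if p c ∧ ⌊ 1 ≤? e c ⌋ then words p s (e ⊖ c) else 0)
              ≡ (if p c ∧ ⌊ 1 ≤? e′ c ⌋ then words p s (e′ ⊖ c) else 0)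
  agree c with p c in pc
  ... | false = refl
  ... | true rewrite e≗e′ c pc =
    cong (if ⌊ 1 ≤? e′ c ⌋ then_else 0) (words-cong p s (e ⊖ c) (e′ ⊖ c)
      (λ c′ pc′ → cong (λ x → if ⌊ c ≟ᶠ c′ ⌋ then x ∸ 1 else x) (e≗e′ c′ pc′)))

words-⊖-outside : ∀ {B} p s (e : Fin B → ℕ) c → p c ≡ false → words p s (e ⊖ c) ≡ words p s e
words-⊖-outside p s e c pc =
  words-cong p s (e ⊖ c) e (λ c′ pc′ → ⊖-other e λ { refl → true≢false (trans (sym pc′) pc) })

words-first-letter : ∀ {B} p (e : Fin B → ℕ) s → total p e ≡ s →
  ∑[ c < B ] (if p c ∧ ⌊ 1 ≤? e c ⌋ then words p (s ∸ 1) (e ⊖ c) else 0) ≡ [ ⌊ 1 ≤? s ⌋ ] * words p s e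
words-first-letter {B} p e zero total≡0 = trans (∑-cong no-letter) (sum-replicate-zero B)
  where
  no-letter : ∀ c → (if p c ∧ ⌊ 1 ≤? e c ⌋ then words p 0 (e ⊖ c) else 0) ≡ 0
  no-letter c with p c in pc
  ... | false = refl
  ... | true rewrite n≤0⇒n≡0 (subst (e c ≤_) total≡0 (term≤total p e c pc)) = refl
words-first-letter p e (suc s) _ = sym (+-identityʳ _)

∏! : ∀ {B} → (Fin B → Bool) → (Fin B → ℕ) → ℕ
∏! p e = ∏ (λ c → if p c then e c ! else 1)

words-∏! : ∀ {B} p s (e : Fin B → ℕ) → total p e ≡ s → words p s e * ∏! p e ≡ s !
words-∏! {B} p zero e total≡0 =
  cong₂ _*_ (cong (λ t → [ ⌊ t ≟ℕ 0 ⌋ ]) total≡0) (trans (∏-cong empty) (∏-one B))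
  where
  empty : ∀ c → (if p c then e c ! else 1) ≡ 1
  empty c with p c in pc
  ... | false = refl
  ... | true rewrite n≤0⇒n≡0 (subst (e c ≤_) total≡0 (term≤total p e c pc)) = refl
words-∏! {B} p (suc s) e total≡1+s = begin
  words p (suc s) e * ∏! p e
    ≡⟨ *-distribʳ-sum (∏! p e) (λ c → if p c ∧ ⌊ 1 ≤? e c ⌋ then words p s (e ⊖ c) else 0) ⟩
  ∑[ c < B ] ((if p c ∧ ⌊ 1 ≤? e c ⌋ then words p s (e ⊖ c) else 0) * ∏! p e)
    ≡⟨ ∑-cong by-first-letter ⟩
  ∑[ c < B ] (s ! * (if p c then e c else 0))
    ≡⟨ *-distribˡ-sum (s !) (λ c → if p c then e c else 0) ⟨
  s ! * total p e
    ≡⟨ cong (s ! *_) total≡1+s ⟩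
  s ! * suc s
    ≡⟨ *-comm (s !) (suc s) ⟩
  suc s ! ∎
  where
  by-first-letter : ∀ c → (if p c ∧ ⌊ 1 ≤? e c ⌋ then words p s (e ⊖ c) else 0) * ∏! p e
                          ≡ s ! * (if p c then e c else 0)
  by-first-letter c with p c in pc | e c in ec
  ... | false | _     = sym (*-zeroʳ (s !))
  ... | true  | zero  = sym (*-zeroʳ (s !))
  ... | true  | suc n = begin
    words p s (e ⊖ c) * ∏! p e                  ≡⟨ cong (words p s (e ⊖ c) *_) (∏-extract c (suc n) _ _ peel) ⟩
    words p s (e ⊖ c) * (∏! p (e ⊖ c) * suc n)  ≡⟨ *-assoc (words p s (e ⊖ c)) _ _ ⟨
    words p s (e ⊖ c) * ∏! p (e ⊖ c) * suc n    ≡⟨ cong (_* suc n) (words-∏! p s (e ⊖ c) total-rest) ⟩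
    s ! * suc n                                 ∎
    where
    total-rest : total p (e ⊖ c) ≡ s
    total-rest = trans (total-⊖-inside p e c pc (subst (1 ≤_) (sym ec) (s≤s z≤n))) (cong (_∸ 1) total≡1+s)
    peel : ∀ c′ → (if p c′ then e c′ ! else 1)
                  ≡ (if p c′ then (e ⊖ c) c′ ! else 1) * (if ⌊ c ≟ᶠ c′ ⌋ then suc n else 1)
    peel c′ with c ≟ᶠ c′
    ... | yes refl rewrite pc | ec = *-comm (suc n) (n !)
    ... | no _     = sym (*-identityʳ _)

sumWhere : ℕ → (ℕ → ℕ) → ℕ → (ℕ → ℕ) → ℕ
sumWhere N g t h = ∑[ j < N ] (if ⌊ g (toℕ j) ≟ℕ t ⌋ then h (toℕ j) else 0)

sumWhere-none : ∀ N g t h → (∀ j → j < N → g j ≢ t) → sumWhere N g t h ≡ 0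
sumWhere-none N g t h g≢t = trans (∑-cong vanish) (sum-replicate-zero N)
  where
  vanish : ∀ j → (if ⌊ g (toℕ j) ≟ℕ t ⌋ then h (toℕ j) else 0) ≡ 0
  vanish j = cong (if_then h (toℕ j) else 0) (⌊⌋-false (g (toℕ j) ≟ℕ t) (g≢t (toℕ j) (toℕ<n j)))

sumWhere-unique : ∀ N g t h → (∀ {x y} → g x ≡ g y → x ≡ y) →
                  ∀ j₀ → g j₀ ≡ t → (N ≤ j₀ → h j₀ ≡ 0) → sumWhere N g t h ≡ h j₀
sumWhere-unique N g t h g-inj j₀ gj₀≡t outside with j₀ <? N
... | yes j₀<N = trans (∑-cong at-j₀) (trans (∑-delta (fromℕ< j₀<N) _) (cong h (toℕ-fromℕ< j₀<N)))
  where
  at-j₀ : ∀ j → (if ⌊ g (toℕ j) ≟ℕ t ⌋ then h (toℕ j) else 0)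
              ≡ (if ⌊ fromℕ< j₀<N ≟ᶠ j ⌋ then h (toℕ j) else 0)
  at-j₀ j = cong (if_then h (toℕ j) else 0) (⌊⌋-⇔ (g (toℕ j) ≟ℕ t) (fromℕ< j₀<N ≟ᶠ j)
    (λ gj≡t → toℕ-injective (trans (toℕ-fromℕ< j₀<N) (g-inj (trans gj₀≡t (sym gj≡t)))))
    (λ { refl → trans (cong g (toℕ-fromℕ< j₀<N)) gj₀≡t }))
... | no j₀≮N = trans (sumWhere-none N g t h none) (sym (outside (≮⇒≥ j₀≮N)))
  where
  none : ∀ j → j < N → g j ≢ t
  none j j<N gj≡t = j₀≮N (subst (_< N) (g-inj (trans gj≡t (sym gj₀≡t))) j<N)

2*suc : ∀ a → 2 * suc a ≡ suc (suc (2 * a))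
2*suc a = cong suc (+-suc a (a + 0))

half? : ∀ d → Dec (∃[ a ] 2 * a ≡ d)
half? zero          = yes (0 , refl)
half? (suc zero)    = no λ { (suc a , 2a≡1) → 0≢1+n (sym (suc-injective (trans (sym (2*suc a)) 2a≡1))) }
half? (suc (suc d)) with half? d
... | yes (a , 2a≡d) = yes (suc a , trans (2*suc a) (cong (suc ∘ suc) 2a≡d))
... | no ∄a         =
  no λ { (suc a , 2a≡d) → ∄a (a , suc-injective (suc-injective (trans (sym (2*suc a)) 2a≡d))) }

gap? : ∀ x y → Dec (∃[ a ] x + 2 * a ≡ y)
gap? x y with x ≤? y
... | no x≰y = no λ (a , x+2a≡y) → x≰y (subst (x ≤_) x+2a≡y (m≤m+n x _))
... | yes x≤y with half? (y ∸ x)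
...   | yes (a , 2a≡y∸x) = yes (a , trans (cong (x +_) 2a≡y∸x) (m+[n∸m]≡n x≤y))
...   | no ∄a            =
  no λ (a , x+2a≡y) → ∄a (a , trans (sym (m+n∸m≡n x (2 * a))) (cong (_∸ x) x+2a≡y))

pick : ℕ → ℕ → ℕ → ℕ → ℕ
pick P Q s a = [ ⌊ a ≤? s ⌋ ] * (P C a) * (Q C (s ∸ a))

-- Choices of the s among P big and Q small leaves that get a colour below the root's, with k
-- ascents: if a of the s are big, the ascents are the P ∸ a other big leaves and the s ∸ a
-- small ones, so k + 2a = s + P.
splits : ℕ → ℕ → ℕ → ℕ → ℕ
splits P Q s k = sumWhere (suc P) (λ a → k + 2 * a) (s + P) (pick P Q s)

pick-beyond : ∀ P Q s a → P < a → pick P Q s a ≡ 0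
pick-beyond P Q s a P<a = begin
  [ ⌊ a ≤? s ⌋ ] * (P C a) * (Q C (s ∸ a))  ≡⟨ cong (λ x → [ ⌊ a ≤? s ⌋ ] * x * (Q C (s ∸ a))) (k>n⇒nCk≡0 P<a) ⟩
  [ ⌊ a ≤? s ⌋ ] * 0 * (Q C (s ∸ a))        ≡⟨ cong (_* (Q C (s ∸ a))) (*-zeroʳ [ ⌊ a ≤? s ⌋ ]) ⟩
  0                                          ∎

splits-at : ∀ P Q s k a → k + 2 * a ≡ s + P → splits P Q s k ≡ pick P Q s a
splits-at P Q s k a k+2a≡s+P =
  sumWhere-unique (suc P) (λ a → k + 2 * a) (s + P) (pick P Q s)
           (λ eq → *-cancelˡ-≡ _ _ 2 (+-cancelˡ-≡ k _ _ eq)) a k+2a≡s+P (pick-beyond P Q s a)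

splits-none : ∀ P Q s k → (∀ a → k + 2 * a ≢ s + P) → splits P Q s k ≡ 0
splits-none P Q s k ∄a = sumWhere-none (suc P) (λ a → k + 2 * a) (s + P) (pick P Q s) (λ a _ → ∄a a)

splits-vanish : ∀ P Q s k → P + Q < s → splits P Q s k ≡ 0
splits-vanish P Q s k P+Q<s with gap? k (s + P)
... | no ∄a = splits-none P Q s k (λ a eq → ∄a (a , eq))
... | yes (a , k+2a≡s+P) with a ≤? P
...   | no a≰P  = trans (splits-at P Q s k a k+2a≡s+P) (pick-beyond P Q s a (≰⇒> a≰P))
...   | yes a≤P = trans (splits-at P Q s k a k+2a≡s+P) (begin
  [ ⌊ a ≤? s ⌋ ] * (P C a) * (Q C (s ∸ a))  ≡⟨ cong ([ ⌊ a ≤? s ⌋ ] * (P C a) *_) (k>n⇒nCk≡0 Q<s∸a) ⟩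
  [ ⌊ a ≤? s ⌋ ] * (P C a) * 0              ≡⟨ *-zeroʳ ([ ⌊ a ≤? s ⌋ ] * (P C a)) ⟩
  0                                          ∎)
  where
  Q<s∸a : Q < s ∸ a
  Q<s∸a = m+n≤o⇒m≤o∸n (suc Q) (≤-trans (+-monoʳ-≤ (suc Q) a≤P) (subst (_< s) (+-comm P Q) P+Q<s))

*-+-*-distrib : ∀ x y z w → x * (y + z) * w ≡ x * y * w + x * z * w
*-+-*-distrib = solve-∀

pick-big-suc : ∀ P Q s a → pick (suc P) Q (suc s) (suc a) ≡ pick P Q s a + pick P Q (suc s) (suc a)
pick-big-suc P Q s a = begin
  [ ⌊ suc a ≤? suc s ⌋ ] * (suc P C suc a) * (Q C (s ∸ a))
    ≡⟨ cong₂ (λ b x → [ b ] * x * (Q C (s ∸ a))) (sym (⌊suc≤?suc⌋ a s))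
             (nCk+nC[k+1]≡[n+1]C[k+1] P a) ⟨
  [ ⌊ a ≤? s ⌋ ] * (P C a + P C suc a) * (Q C (s ∸ a))
    ≡⟨ *-+-*-distrib [ ⌊ a ≤? s ⌋ ] (P C a) (P C suc a) (Q C (s ∸ a)) ⟩
  [ ⌊ a ≤? s ⌋ ] * (P C a) * (Q C (s ∸ a)) + [ ⌊ a ≤? s ⌋ ] * (P C suc a) * (Q C (s ∸ a))
    ≡⟨ cong (λ b → pick P Q s a + [ b ] * (P C suc a) * (Q C (s ∸ a))) (⌊suc≤?suc⌋ a s) ⟨
  pick P Q s a + pick P Q (suc s) (suc a) ∎

+2*suc : ∀ k a → k + 2 * suc a ≡ suc (suc (k + 2 * a))
+2*suc = solve-∀

+-suc-double : ∀ a → a + suc a ≡ suc (2 * a)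
+-suc-double = solve-∀

shift-a : ∀ k a s P → k + 2 * a ≡ s + P → k + 2 * suc a ≡ suc s + suc P
shift-a k a s P eq = trans (+2*suc k a) (cong suc (trans (cong suc eq) (sym (+-suc s P))))

unshift-a : ∀ k a s P → k + 2 * suc a ≡ suc s + suc P → k + 2 * a ≡ s + P
unshift-a k a s P eq = suc-injective (suc-injective (trans (sym (+2*suc k a)) (trans eq (cong suc (+-suc s P)))))

shift-k : ∀ k a s P → k + 2 * a ≡ s + P → suc k + 2 * a ≡ s + suc P
shift-k k a s P eq = trans (cong suc eq) (sym (+-suc s P))

unshift-k : ∀ k a s P → suc k + 2 * a ≡ s + suc P → k + 2 * a ≡ s + P
unshift-k k a s P eq = suc-injective (trans eq (+-suc s P))

splits-big : ∀ P Q s k →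
  splits (suc P) Q s k ≡ [ ⌊ 1 ≤? s ⌋ ] * splits P Q (s ∸ 1) k
                       + [ ⌊ 1 ≤? k ⌋ ] * splits P Q s (k ∸ 1)
splits-big P Q s k with gap? k (s + suc P)
... | no ∄a =
  trans (splits-none (suc P) Q s k (λ a eq → ∄a (a , eq))) (sym (no-split s k (λ a eq → ∄a (a , eq))))
  where
  no-split : ∀ s k → (∀ a → k + 2 * a ≢ s + suc P) →
             [ ⌊ 1 ≤? s ⌋ ] * splits P Q (s ∸ 1) k + [ ⌊ 1 ≤? k ⌋ ] * splits P Q s (k ∸ 1) ≡ 0
  no-split zero    zero    ∄a = refl
  no-split zero    (suc k) ∄a = trans (*-identityˡ _) (splits-none P Q 0 k λ a eq → ∄a a (cong suc eq))
  no-split (suc s) zero    ∄a =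
    trans (+-identityʳ _)
          (trans (*-identityˡ _) (splits-none P Q s 0 λ a eq → ∄a (suc a) (shift-a 0 a s P eq)))
  no-split (suc s) (suc k) ∄a =
    cong₂ _+_ (trans (*-identityˡ _)
                     (splits-none P Q s (suc k) λ a eq → ∄a (suc a) (shift-a (suc k) a s P eq)))
              (trans (*-identityˡ _) (splits-none P Q (suc s) k λ a eq → ∄a a (shift-k k a (suc s) P eq)))
... | yes (a , eq) = trans (splits-at (suc P) Q s k a eq) (split s k a eq)
  where
  split : ∀ s k a → k + 2 * a ≡ s + suc P →
          pick (suc P) Q s a ≡ [ ⌊ 1 ≤? s ⌋ ] * splits P Q (s ∸ 1) k
                             + [ ⌊ 1 ≤? k ⌋ ] * splits P Q s (k ∸ 1)
  split s       zero    zero    eq = ⊥-elim (0≢1+n (trans eq (+-suc s P)))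
  split zero    (suc k) zero    eq = sym (trans (*-identityˡ _) (splits-at P Q 0 k 0 (suc-injective eq)))
  split (suc s) (suc k) zero    eq =
    sym (cong₂ _+_ (trans (*-identityˡ _) (splits-none P Q s (suc k) too-few-ascents))
                   (trans (*-identityˡ _) (splits-at P Q (suc s) k 0 (unshift-k k 0 (suc s) P eq))))
    where
    too-few-ascents : ∀ b → suc k + 2 * b ≢ s + P
    too-few-ascents b eq′ = 1+n≰n (≤-trans (≤-reflexive 1+s+P≡k)
                                   (≤-trans (n≤1+n k) (subst (suc k ≤_) eq′ (m≤m+n (suc k) (2 * b)))))
      where
      1+s+P≡k : suc (s + P) ≡ k
      1+s+P≡k = sym (trans (sym (+-identityʳ k)) (trans (suc-injective eq) (+-suc s P)))
  split zero    zero    (suc a) eq = refl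
  split zero    (suc k) (suc a) eq = sym (trans (*-identityˡ _) (splits-at P Q 0 k (suc a) (suc-injective eq)))
  split (suc s) zero    (suc a) eq =
    trans (pick-big-suc P Q s a)
          (cong₂ _+_ (sym (trans (*-identityˡ _) (splits-at P Q s 0 a 2a≡s+P))) no-extra-big)
    where
    2a≡s+P : 0 + 2 * a ≡ s + P
    2a≡s+P = unshift-a 0 a s P eq
    no-extra-big : pick P Q (suc s) (suc a) ≡ 0
    no-extra-big with a ≤? s
    ... | no a≰s =
      cong (λ b → [ b ] * (P C suc a) * (Q C (s ∸ a))) (trans (⌊suc≤?suc⌋ a s) (⌊⌋-false (a ≤? s) a≰s))
    ... | yes a≤s with suc a ≤? P
    ...   | no a≮P = pick-beyond P Q (suc s) (suc a) (≰⇒> a≮P)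
    ...   | yes a<P = ⊥-elim (1+n≰n (subst (suc (2 * a) ≤_) (sym 2a≡s+P)
                                      (subst (_≤ s + P) (+-suc-double a) (+-mono-≤ a≤s a<P))))
  split (suc s) (suc k) (suc a) eq =
    trans (pick-big-suc P Q s a)
          (sym (cong₂ _+_ (trans (*-identityˡ _) (splits-at P Q s (suc k) a (unshift-a (suc k) a s P eq)))
                          (trans (*-identityˡ _)
                                 (splits-at P Q (suc s) k (suc a) (unshift-k k (suc a) (suc s) P eq)))))

pick-small-none : ∀ P Q s a → s ∸ a ≡ 0 → pick P (suc Q) s a ≡ pick P Q s a
pick-small-none P Q s a s∸a≡0 =
  cong ([ ⌊ a ≤? s ⌋ ] * (P C a) *_) (trans (cong (suc Q C_) s∸a≡0) (cong (Q C_) (sym s∸a≡0)))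

pick-small-suc : ∀ P Q s a → a ≤ s → pick P (suc Q) (suc s) a ≡ pick P Q s a + pick P Q (suc s) a
pick-small-suc P Q s a a≤s = begin
  [ ⌊ a ≤? suc s ⌋ ] * (P C a) * (suc Q C (suc s ∸ a))
    ≡⟨ cong (λ b → [ b ] * (P C a) * (suc Q C (suc s ∸ a))) a≤1+s ⟩
  1 * (P C a) * (suc Q C (suc s ∸ a))
    ≡⟨ cong (λ x → 1 * (P C a) * (suc Q C x)) (+-∸-assoc 1 a≤s) ⟩
  1 * (P C a) * (suc Q C suc (s ∸ a))
    ≡⟨ cong (1 * (P C a) *_) (nCk+nC[k+1]≡[n+1]C[k+1] Q (s ∸ a)) ⟨
  1 * (P C a) * (Q C (s ∸ a) + Q C suc (s ∸ a))
    ≡⟨ *-distribˡ-+ (1 * (P C a)) (Q C (s ∸ a)) _ ⟩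
  1 * (P C a) * (Q C (s ∸ a)) + 1 * (P C a) * (Q C suc (s ∸ a))
    ≡⟨ cong₂ (λ b b′ → [ b ] * (P C a) * (Q C (s ∸ a)) + [ b′ ] * (P C a) * (Q C suc (s ∸ a)))
             (sym (⌊⌋-true (a ≤? s) a≤s)) (sym a≤1+s) ⟩
  [ ⌊ a ≤? s ⌋ ] * (P C a) * (Q C (s ∸ a)) + [ ⌊ a ≤? suc s ⌋ ] * (P C a) * (Q C suc (s ∸ a))
    ≡⟨ cong (λ x → pick P Q s a + [ ⌊ a ≤? suc s ⌋ ] * (P C a) * (Q C x)) (+-∸-assoc 1 a≤s) ⟨
  pick P Q s a + pick P Q (suc s) a ∎
  where
  a≤1+s : ⌊ a ≤? suc s ⌋ ≡ true
  a≤1+s = ⌊⌋-true (a ≤? suc s) (m≤n⇒m≤1+n a≤s)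

splits-small : ∀ P Q s k →
  splits P (suc Q) s k ≡ [ ⌊ 1 ≤? s ⌋ ] * ([ ⌊ 1 ≤? k ⌋ ] * splits P Q (s ∸ 1) (k ∸ 1)) + splits P Q s k
splits-small P Q s k with gap? k (s + P)
... | no ∄a =
  trans (splits-none P (suc Q) s k ∄a′) (sym (cong₂ _+_ (no-split s k ∄a′) (splits-none P Q s k ∄a′)))
  where
  ∄a′ : ∀ a → k + 2 * a ≢ s + P
  ∄a′ a eq = ∄a (a , eq)
  no-split : ∀ s k → (∀ a → k + 2 * a ≢ s + P) →
             [ ⌊ 1 ≤? s ⌋ ] * ([ ⌊ 1 ≤? k ⌋ ] * splits P Q (s ∸ 1) (k ∸ 1)) ≡ 0
  no-split zero    k       ∄a = refl
  no-split (suc s) zero    ∄a = refl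
  no-split (suc s) (suc k) ∄a =
    trans (*-identityˡ _) (trans (*-identityˡ _) (splits-none P Q s k λ a eq → ∄a a (cong suc eq)))
... | yes (a , eq) = trans (splits-at P (suc Q) s k a eq)
                           (trans (split s k eq) (cong (step +_) (sym (splits-at P Q s k a eq))))
  where
  step : ℕ
  step = [ ⌊ 1 ≤? s ⌋ ] * ([ ⌊ 1 ≤? k ⌋ ] * splits P Q (s ∸ 1) (k ∸ 1))
  split : ∀ s k → k + 2 * a ≡ s + P →
          pick P (suc Q) s a ≡ [ ⌊ 1 ≤? s ⌋ ] * ([ ⌊ 1 ≤? k ⌋ ] * splits P Q (s ∸ 1) (k ∸ 1))
                             + pick P Q s a
  split zero    k       eq = pick-small-none P Q 0 a (0∸n≡0 a)
  split (suc s) zero    eq with a ≤? P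
  ... | no a≰P  =
    trans (pick-beyond P (suc Q) (suc s) a (≰⇒> a≰P)) (sym (pick-beyond P Q (suc s) a (≰⇒> a≰P)))
  ... | yes a≤P = pick-small-none P Q (suc s) a (m≤n⇒m∸n≡0 1+s≤a)
    where
    1+s≤a : suc s ≤ a
    1+s≤a = +-cancelʳ-≤ a (suc s) a
              (subst (suc s + a ≤_) (trans (sym eq) (cong (a +_) (+-identityʳ a))) (+-monoʳ-≤ (suc s) a≤P))
  split (suc s) (suc k) eq with a ≤? s
  ... | yes a≤s = trans (pick-small-suc P Q s a a≤s)
                        (cong (_+ pick P Q (suc s) a) (sym (trans (*-identityˡ _) (trans (*-identityˡ _)
                          (splits-at P Q s k a (suc-injective eq))))))
  ... | no a≰s  = trans (pick-small-none P Q (suc s) a (m≤n⇒m∸n≡0 (≰⇒> a≰s)))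
                        (cong (_+ pick P Q (suc s) a) (sym (trans (*-identityˡ _) (trans (*-identityˡ _)
                          (trans (splits-at P Q s k a (suc-injective eq))
                                 (cong (λ b → [ b ] * (P C a) * (Q C (s ∸ a))) (⌊⌋-false (a ≤? s) a≰s)))))))

ways : ℕ → ℕ → ℕ → ℕ → ℕ → ℕ
ways P Q s t k = [ ⌊ s + t ≟ℕ P + Q ⌋ ] * splits P Q s k

fits-after-low : ∀ s t N x →
  [ ⌊ s + t ≟ℕ suc N ⌋ ] * ([ ⌊ 1 ≤? s ⌋ ] * x) ≡ [ ⌊ 1 ≤? s ⌋ ] * ([ ⌊ s ∸ 1 + t ≟ℕ N ⌋ ] * x)
fits-after-low zero    t N x = *-zeroʳ [ ⌊ t ≟ℕ suc N ⌋ ]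
fits-after-low (suc s) t N x =
  trans (cong₂ (λ b y → [ b ] * y) (⌊suc≟suc⌋ (s + t) N) (*-identityˡ x)) (sym (*-identityˡ _))

fits-after-high : ∀ s t N y → (s ≡ suc N → y ≡ 0) →
            [ ⌊ s + t ≟ℕ suc N ⌋ ] * y ≡ [ ⌊ 1 ≤? t ⌋ ] * ([ ⌊ s + (t ∸ 1) ≟ℕ N ⌋ ] * y)
fits-after-high s zero N y overfull with s + 0 ≟ℕ suc N
... | yes s+0≡1+N = trans (*-identityˡ y) (overfull (trans (sym (+-identityʳ s)) s+0≡1+N))
... | no _        = refl
fits-after-high s (suc t) N y _ =
  trans (cong (λ b → [ b ] * y) (⌊⌋-⇔ (s + suc t ≟ℕ suc N) (s + t ≟ℕ N)
                                    (λ eq → suc-injective (trans (sym (+-suc s t)) eq))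
                                    (λ eq → trans (+-suc s t) (cong suc eq))))
        (sym (*-identityˡ _))

ways-big : ∀ P Q s t k →
  ways (suc P) Q s t k ≡ [ ⌊ 1 ≤? s ⌋ ] * ways P Q (s ∸ 1) t k
                       + [ ⌊ 1 ≤? t ⌋ ] * ([ ⌊ 1 ≤? k ⌋ ] * ways P Q s (t ∸ 1) (k ∸ 1))
ways-big P Q s t k = begin
  [ fits ] * splits (suc P) Q s k
    ≡⟨ cong ([ fits ] *_) (splits-big P Q s k) ⟩
  [ fits ] * (low * X + asc * Y)
    ≡⟨ *-distribˡ-+ [ fits ] (low * X) (asc * Y) ⟩
  [ fits ] * (low * X) + [ fits ] * (asc * Y)
    ≡⟨ cong₂ _+_ (fits-after-low s t (P + Q) X) (x*[y*z]≡y*[x*z] [ fits ] asc Y) ⟩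
  low * ways P Q (s ∸ 1) t k + asc * ([ fits ] * Y)
    ≡⟨ cong (λ y → low * ways P Q (s ∸ 1) t k + asc * y)
            (fits-after-high s t (P + Q) Y λ s≡ → splits-vanish P Q s (k ∸ 1) (≤-reflexive (sym s≡))) ⟩
  low * ways P Q (s ∸ 1) t k + asc * (high * ways P Q s (t ∸ 1) (k ∸ 1))
    ≡⟨ cong (low * ways P Q (s ∸ 1) t k +_) (x*[y*z]≡y*[x*z] asc high (ways P Q s (t ∸ 1) (k ∸ 1))) ⟩
  low * ways P Q (s ∸ 1) t k + high * (asc * ways P Q s (t ∸ 1) (k ∸ 1)) ∎
  where
  fits : Bool
  fits = ⌊ s + t ≟ℕ suc (P + Q) ⌋
  low high asc X Y : ℕ
  low  = [ ⌊ 1 ≤? s ⌋ ]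
  high = [ ⌊ 1 ≤? t ⌋ ]
  asc  = [ ⌊ 1 ≤? k ⌋ ]
  X    = splits P Q (s ∸ 1) k
  Y    = splits P Q s (k ∸ 1)

ways-small : ∀ P Q s t k →
  ways P (suc Q) s t k ≡ [ ⌊ 1 ≤? s ⌋ ] * ([ ⌊ 1 ≤? k ⌋ ] * ways P Q (s ∸ 1) t (k ∸ 1))
                       + [ ⌊ 1 ≤? t ⌋ ] * ways P Q s (t ∸ 1) k
ways-small P Q s t k = begin
  [ ⌊ s + t ≟ℕ P + suc Q ⌋ ] * splits P (suc Q) s k
    ≡⟨ cong₂ (λ N x → [ ⌊ s + t ≟ℕ N ⌋ ] * x) (+-suc P Q) (splits-small P Q s k) ⟩
  [ fits ] * (low * (asc * X) + Y)
    ≡⟨ *-distribˡ-+ [ fits ] (low * (asc * X)) Y ⟩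
  [ fits ] * (low * (asc * X)) + [ fits ] * Y
    ≡⟨ cong₂ _+_ (fits-after-low s t (P + Q) (asc * X))
                 (fits-after-high s t (P + Q) Y λ s≡ → splits-vanish P Q s k (≤-reflexive (sym s≡))) ⟩
  low * ([ ⌊ s ∸ 1 + t ≟ℕ P + Q ⌋ ] * (asc * X)) + high * ways P Q s (t ∸ 1) k
    ≡⟨ cong (λ y → low * y + high * ways P Q s (t ∸ 1) k)
            (x*[y*z]≡y*[x*z] [ ⌊ s ∸ 1 + t ≟ℕ P + Q ⌋ ] asc X) ⟩
  low * (asc * ways P Q (s ∸ 1) t (k ∸ 1)) + high * ways P Q s (t ∸ 1) k ∎
  where
  fits : Bool
  fits = ⌊ s + t ≟ℕ suc (P + Q) ⌋
  low high asc X Y : ℕ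
  low  = [ ⌊ 1 ≤? s ⌋ ]
  high = [ ⌊ 1 ≤? t ⌋ ]
  asc  = [ ⌊ 1 ≤? k ⌋ ]
  X    = splits P Q (s ∸ 1) (k ∸ 1)
  Y    = splits P Q s k


-- A vertex of the star is the root or a leaf whose label is bigger or smaller than the root's.
data Role : Set where
  root big small : Role

_≡ᴿ_ : Role → Role → Bool
root  ≡ᴿ root  = true
big   ≡ᴿ big   = true
small ≡ᴿ small = true
_     ≡ᴿ _     = false

# : Role → ∀ {m} → (Fin m → Role) → ℕ
# r {m} ρ = ∑[ v < m ] [ ρ v ≡ᴿ r ]

lowAscent highAscent : Role → ℕ
lowAscent small = 1
lowAscent _     = 0
highAscent big = 1
highAscent _   = 0

module RootColour {B : ℕ} (c₀ : Fin B) where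

  low high : Fin B → Bool
  low  c = ⌊ toℕ c <? toℕ c₀ ⌋
  high c = ⌊ toℕ c₀ <? toℕ c ⌋

  allowed : Role → Fin B → Bool
  allowed root  c = ⌊ c₀ ≟ᶠ c ⌋
  allowed big   c = ⌊ ¬? (toℕ c ≟ℕ toℕ c₀) ⌋
  allowed small c = ⌊ ¬? (toℕ c ≟ℕ toℕ c₀) ⌋

  ascent : Role → Fin B → ℕ
  ascent root  c = 0
  ascent big   c = [ high c ]
  ascent small c = [ low c ]

  low⇒≢ : ∀ {c} → low c ≡ true → c₀ ≢ c
  low⇒≢ {c} lc refl = true≢false (trans (sym lc) (⌊⌋-false (toℕ c <? toℕ c) (n≮n _)))

  high⇒≢ : ∀ {c} → high c ≡ true → c₀ ≢ c
  high⇒≢ {c} hc refl = true≢false (trans (sym hc) (⌊⌋-false (toℕ c <? toℕ c) (n≮n _)))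

  low⇒¬high : ∀ {c} → low c ≡ true → high c ≡ false
  low⇒¬high {c} lc with toℕ c <? toℕ c₀
  ... | yes c<c₀ = ⌊⌋-false (toℕ c₀ <? toℕ c) (<-asym c<c₀)

  high⇒¬low : ∀ {c} → high c ≡ true → low c ≡ false
  high⇒¬low {c} hc with toℕ c₀ <? toℕ c
  ... | yes c₀<c = ⌊⌋-false (toℕ c <? toℕ c₀) (<-asym c₀<c)

  allowed-leaf : ∀ r → r ≢ root → ∀ {c} → c₀ ≢ c → allowed r c ≡ true
  allowed-leaf root  r≢root _    = ⊥-elim (r≢root refl)
  allowed-leaf big   _      c₀≢c = ⌊⌋-true (¬? (_ ≟ℕ _)) (λ eq → c₀≢c (toℕ-injective (sym eq)))
  allowed-leaf small _      c₀≢c = ⌊⌋-true (¬? (_ ≟ℕ _)) (λ eq → c₀≢c (toℕ-injective (sym eq)))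

  allowed-leaf-c₀ : ∀ r → r ≢ root → allowed r c₀ ≡ false
  allowed-leaf-c₀ root  r≢root = ⊥-elim (r≢root refl)
  allowed-leaf-c₀ big   _      = ⌊⌋-false (¬? (_ ≟ℕ _)) (λ c₀≢c₀ → c₀≢c₀ refl)
  allowed-leaf-c₀ small _      = ⌊⌋-false (¬? (_ ≟ℕ _)) (λ c₀≢c₀ → c₀≢c₀ refl)

  ascent-low : ∀ r {c} → low c ≡ true → ascent r c ≡ lowAscent r
  ascent-low root  lc = refl
  ascent-low big   lc = cong [_] (low⇒¬high lc)
  ascent-low small lc = cong [_] lc

  ascent-high : ∀ r {c} → high c ≡ true → ascent r c ≡ highAscent r
  ascent-high root  hc = refl
  ascent-high big   hc = cong [_] hc
  ascent-high small hc = cong [_] (high⇒¬low hc)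

  ∑-by-side : (f : Fin B → ℕ) →
              ∑[ c < B ] f c ≡ f c₀ + (∑[ c < B ] (if low c then f c else 0)
                                      + ∑[ c < B ] (if high c then f c else 0))
  ∑-by-side f = begin
    ∑[ c < B ] f c
      ≡⟨ ∑-cong split ⟩
    ∑[ c < B ] (at c + (below c + above c))
      ≡⟨ ∑-distrib-+ at (λ c → below c + above c) ⟩
    ∑[ c < B ] at c + ∑[ c < B ] (below c + above c)
      ≡⟨ cong₂ _+_ (∑-delta c₀ f) (∑-distrib-+ below above) ⟩
    f c₀ + (∑[ c < B ] below c + ∑[ c < B ] above c) ∎
    where
    at below above : Fin B → ℕ
    at    c = if ⌊ c₀ ≟ᶠ c ⌋ then f c else 0
    below c = if low c then f c else 0
    above c = if high c then f c else 0
    split : ∀ c → f c ≡ at c + (below c + above c)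
    split c with <-cmp (toℕ c) (toℕ c₀)
    ... | tri< c<c₀ c≢c₀ _ rewrite ⌊⌋-false (c₀ ≟ᶠ c) (λ eq → c≢c₀ (cong toℕ (sym eq)))
                                 | ⌊⌋-true (toℕ c <? toℕ c₀) c<c₀
                                 | ⌊⌋-false (toℕ c₀ <? toℕ c) (<-asym c<c₀)
                                 = sym (+-identityʳ (f c))
    ... | tri≈ _ c≡c₀ _ rewrite toℕ-injective c≡c₀
                              | ⌊≟ᶠ⌋-refl c₀ | ⌊⌋-false (toℕ c₀ <? toℕ c₀) (n≮n _)
                              = sym (+-identityʳ (f c₀))
    ... | tri> _ c≢c₀ c₀<c rewrite ⌊⌋-false (c₀ ≟ᶠ c) (λ eq → c≢c₀ (cong toℕ (sym eq)))
                                 | ⌊⌋-false (toℕ c <? toℕ c₀) (<-asym c₀<c)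
                                 | ⌊⌋-true (toℕ c₀ <? toℕ c) c₀<c
                                 = refl

  -- x is the multiplicity of c₀, s and t count the low and high leaves, ml and mh the words.
  closedForm′ : ∀ {m} → (Fin m → Role) → (x s t ml mh k : ℕ) → ℕ
  closedForm′ ρ x s t ml mh k = [ ⌊ x ≟ℕ # root ρ ⌋ ] * (ml * mh * ways (# big ρ) (# small ρ) s t k)

  closedForm : ∀ {m} → (Fin m → Role) → (Fin B → ℕ) → ℕ → ℕ
  closedForm ρ e k =
    closedForm′ ρ (e c₀) (total low e) (total high e) (words low (total low e) e) (words high (total high e) e) k

  closedForm′-cong : ∀ {m} (ρ : Fin m → Role) {x x′ s s′ t t′ ml ml′ mh mh′} k →
                     x ≡ x′ → s ≡ s′ → t ≡ t′ → ml ≡ ml′ → mh ≡ mh′ →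
                     closedForm′ ρ x s t ml mh k ≡ closedForm′ ρ x′ s′ t′ ml′ mh′ k
  closedForm′-cong ρ k refl refl refl refl refl = refl

  low-c₀ : low c₀ ≡ false
  low-c₀ = ⌊⌋-false (toℕ c₀ <? toℕ c₀) (n≮n _)

  high-c₀ : high c₀ ≡ false
  high-c₀ = ⌊⌋-false (toℕ c₀ <? toℕ c₀) (n≮n _)

  module _ {m} (ρ : Fin m → Role) (e : Fin B → ℕ) where

    S T : ℕ
    S = total low e
    T = total high e

    closedForm-⊖-c₀ : ∀ k → closedForm ρ (e ⊖ c₀) k ≡ closedForm′ ρ (e c₀ ∸ 1) S T (words low S e) (words high T e) k
    closedForm-⊖-c₀ k =
      closedForm′-cong ρ k (⊖-self e c₀) S′ T′
        (trans (cong (λ s → words low s (e ⊖ c₀)) S′) (words-⊖-outside low S e c₀ low-c₀))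
        (trans (cong (λ t → words high t (e ⊖ c₀)) T′) (words-⊖-outside high T e c₀ high-c₀))
      where
      S′ : total low (e ⊖ c₀) ≡ S
      S′ = total-⊖-outside low e c₀ low-c₀
      T′ : total high (e ⊖ c₀) ≡ T
      T′ = total-⊖-outside high e c₀ high-c₀

    closedForm-⊖-low : ∀ k {c} → low c ≡ true → 1 ≤ e c →
      closedForm ρ (e ⊖ c) k ≡ closedForm′ ρ (e c₀) (S ∸ 1) T (words low (S ∸ 1) (e ⊖ c)) (words high T e) k
    closedForm-⊖-low k {c} lc 1≤ec =
      closedForm′-cong ρ k (⊖-other e (≢-sym (low⇒≢ lc))) S′ T′
        (cong (λ s → words low s (e ⊖ c)) S′)
        (trans (cong (λ t → words high t (e ⊖ c)) T′) (words-⊖-outside high T e c (low⇒¬high lc)))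
      where
      S′ : total low (e ⊖ c) ≡ S ∸ 1
      S′ = total-⊖-inside low e c lc 1≤ec
      T′ : total high (e ⊖ c) ≡ T
      T′ = total-⊖-outside high e c (low⇒¬high lc)

    closedForm-⊖-high : ∀ k {c} → high c ≡ true → 1 ≤ e c →
      closedForm ρ (e ⊖ c) k ≡ closedForm′ ρ (e c₀) S (T ∸ 1) (words low S e) (words high (T ∸ 1) (e ⊖ c)) k
    closedForm-⊖-high k {c} hc 1≤ec =
      closedForm′-cong ρ k (⊖-other e (≢-sym (high⇒≢ hc))) S′ T′
        (trans (cong (λ s → words low s (e ⊖ c)) S′) (words-⊖-outside low S e c (high⇒¬low hc)))
        (cong (λ t → words high t (e ⊖ c)) T′)
      where
      S′ : total low (e ⊖ c) ≡ S
      S′ = total-⊖-outside low e c (high⇒¬low hc)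
      T′ : total high (e ⊖ c) ≡ T ∸ 1
      T′ = total-⊖-inside high e c hc 1≤ec

    ML MH : ℕ
    ML = words low S e
    MH = words high T e

    step-root : ∀ k → ∑[ c < B ] (if admits (allowed root) (ascent root) e k c
                                   then closedForm ρ (e ⊖ c) (k ∸ ascent root c) else 0)
                      ≡ closedForm (root ∷ᵛ ρ) e k
    step-root k = begin
      ∑[ c < B ] (if ⌊ c₀ ≟ᶠ c ⌋ ∧ ⌊ 1 ≤? e c ⌋ ∧ true then closedForm ρ (e ⊖ c) k else 0)
        ≡⟨ ∑-cong (λ c → if-∧ ⌊ c₀ ≟ᶠ c ⌋) ⟩
      ∑[ c < B ] (if ⌊ c₀ ≟ᶠ c ⌋ then (if ⌊ 1 ≤? e c ⌋ ∧ true then closedForm ρ (e ⊖ c) k else 0) else 0)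
        ≡⟨ ∑-delta c₀ (λ c → if ⌊ 1 ≤? e c ⌋ ∧ true then closedForm ρ (e ⊖ c) k else 0) ⟩
      (if ⌊ 1 ≤? e c₀ ⌋ ∧ true then closedForm ρ (e ⊖ c₀) k else 0)
        ≡⟨ cong (if ⌊ 1 ≤? e c₀ ⌋ ∧ true then_else 0) (closedForm-⊖-c₀ k) ⟩
      (if ⌊ 1 ≤? e c₀ ⌋ ∧ true then closedForm′ ρ (e c₀ ∸ 1) S T ML MH k else 0)
        ≡⟨ one-more-root (e c₀) ⟩
      closedForm (root ∷ᵛ ρ) e k ∎
      where
      one-more-root : ∀ x → (if ⌊ 1 ≤? x ⌋ ∧ true then closedForm′ ρ (x ∸ 1) S T ML MH k else 0)
                            ≡ closedForm′ (root ∷ᵛ ρ) x S T ML MH k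
      one-more-root zero    = refl
      one-more-root (suc x) =
        cong (λ b → [ b ] * (ML * MH * ways (# big ρ) (# small ρ) S T k)) (sym (⌊suc≟suc⌋ x (# root ρ)))

    step-leaf : ∀ r → r ≢ root → ∀ k →
      ∑[ c < B ] (if admits (allowed r) (ascent r) e k c then closedForm ρ (e ⊖ c) (k ∸ ascent r c) else 0)
      ≡ [ ⌊ e c₀ ≟ℕ # root ρ ⌋ ] * (ML * MH *
          ( [ ⌊ 1 ≤? S ⌋ ] * ([ ⌊ lowAscent r ≤? k ⌋ ]
                              * ways (# big ρ) (# small ρ) (S ∸ 1) T (k ∸ lowAscent r))
          + [ ⌊ 1 ≤? T ⌋ ] * ([ ⌊ highAscent r ≤? k ⌋ ]
                              * ways (# big ρ) (# small ρ) S (T ∸ 1) (k ∸ highAscent r))))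
    step-leaf r r≢root k = begin
      ∑[ c < B ] f c
        ≡⟨ ∑-by-side f ⟩
      f c₀ + (∑[ c < B ] (if low c then f c else 0) + ∑[ c < B ] (if high c then f c else 0))
        ≡⟨ cong₂ _+_ f-c₀
             (cong₂ _+_ (∑-side low S (lowAscent r) low⇒≢ (ascent-low r) (gL * (x * (MH * WL))) low-term refl)
                        (∑-side high T (highAscent r) high⇒≢ (ascent-high r) (gH * (x * (ML * WH))) high-term refl)) ⟩
      0 + ((gL * (x * (MH * WL))) * ([ ⌊ 1 ≤? S ⌋ ] * ML) + (gH * (x * (ML * WH))) * ([ ⌊ 1 ≤? T ⌋ ] * MH))
        ≡⟨ regroup x ML MH gL gH WL WH [ ⌊ 1 ≤? S ⌋ ] [ ⌊ 1 ≤? T ⌋ ] ⟩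
      x * (ML * MH * ([ ⌊ 1 ≤? S ⌋ ] * (gL * WL) + [ ⌊ 1 ≤? T ⌋ ] * (gH * WH))) ∎
      where
      f : Fin B → ℕ
      f c = if admits (allowed r) (ascent r) e k c then closedForm ρ (e ⊖ c) (k ∸ ascent r c) else 0
      x gL gH WL WH : ℕ
      x  = [ ⌊ e c₀ ≟ℕ # root ρ ⌋ ]
      gL = [ ⌊ lowAscent r ≤? k ⌋ ]
      gH = [ ⌊ highAscent r ≤? k ⌋ ]
      WL = ways (# big ρ) (# small ρ) (S ∸ 1) T (k ∸ lowAscent r)
      WH = ways (# big ρ) (# small ρ) S (T ∸ 1) (k ∸ highAscent r)
      regroup : ∀ x ml mh gl gh wl wh sl th →
        0 + ((gl * (x * (mh * wl))) * (sl * ml) + (gh * (x * (ml * wh))) * (th * mh))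
        ≡ x * (ml * mh * (sl * (gl * wl) + th * (gh * wh)))
      regroup = solve-∀
      f-c₀ : f c₀ ≡ 0
      f-c₀ = cong (λ b → if b ∧ ⌊ 1 ≤? e c₀ ⌋ ∧ ⌊ ascent r c₀ ≤? k ⌋
                         then closedForm ρ (e ⊖ c₀) (k ∸ ascent r c₀) else 0)
                  (allowed-leaf-c₀ r r≢root)
      if-scale : ∀ b K y → (if b then K * y else 0) ≡ K * (if b then y else 0)
      if-scale true  K y = refl
      if-scale false K y = sym (*-zeroʳ K)
      ∑-side : ∀ side s a → (∀ {c} → side c ≡ true → c₀ ≢ c) → (∀ {c} → side c ≡ true → ascent r c ≡ a) →
               ∀ K → (∀ {c} → side c ≡ true → 1 ≤ e c →
                      [ ⌊ a ≤? k ⌋ ] * closedForm ρ (e ⊖ c) (k ∸ a) ≡ K * words side (s ∸ 1) (e ⊖ c)) →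
               total side e ≡ s →
               ∑[ c < B ] (if side c then f c else 0) ≡ K * ([ ⌊ 1 ≤? s ⌋ ] * words side s e)
      ∑-side side s a side⇒≢ ascent≡a K removed total≡s = begin
        ∑[ c < B ] (if side c then f c else 0)
          ≡⟨ ∑-cong term ⟩
        ∑[ c < B ] (if side c ∧ ⌊ 1 ≤? e c ⌋ then K * words side (s ∸ 1) (e ⊖ c) else 0)
          ≡⟨ ∑-cong (λ c → if-scale (side c ∧ ⌊ 1 ≤? e c ⌋) K _) ⟩
        ∑[ c < B ] (K * (if side c ∧ ⌊ 1 ≤? e c ⌋ then words side (s ∸ 1) (e ⊖ c) else 0))
          ≡⟨ *-distribˡ-sum K (λ c → if side c ∧ ⌊ 1 ≤? e c ⌋ then words side (s ∸ 1) (e ⊖ c) else 0)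
           ⟨
        K * ∑[ c < B ] (if side c ∧ ⌊ 1 ≤? e c ⌋ then words side (s ∸ 1) (e ⊖ c) else 0)
          ≡⟨ cong (K *_) (words-first-letter side e s total≡s) ⟩
        K * ([ ⌊ 1 ≤? s ⌋ ] * words side s e) ∎
        where
        term : ∀ c → (if side c then f c else 0)
                     ≡ (if side c ∧ ⌊ 1 ≤? e c ⌋ then K * words side (s ∸ 1) (e ⊖ c) else 0)
        term c with side c in sc
        ... | false = refl
        ... | true rewrite allowed-leaf r r≢root (side⇒≢ sc) | ascent≡a sc with 1 ≤? e c
        ...   | no _     = refl
        ...   | yes 1≤ec = trans (if-then-0 ⌊ a ≤? k ⌋ _) (removed sc 1≤ec)
      low-term : ∀ {c} → low c ≡ true → 1 ≤ e c →
                 gL * closedForm ρ (e ⊖ c) (k ∸ lowAscent r) ≡ gL * (x * (MH * WL)) * words low (S ∸ 1) (e ⊖ c)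
      low-term lc 1≤ec =
        trans (cong (gL *_) (closedForm-⊖-low (k ∸ lowAscent r) lc 1≤ec)) (shuffle gL x _ MH WL)
        where
        shuffle : ∀ g x w h W → g * (x * (w * h * W)) ≡ g * (x * (h * W)) * w
        shuffle = solve-∀
      high-term : ∀ {c} → high c ≡ true → 1 ≤ e c →
                  gH * closedForm ρ (e ⊖ c) (k ∸ highAscent r) ≡ gH * (x * (ML * WH)) * words high (T ∸ 1) (e ⊖ c)
      high-term hc 1≤ec =
        trans (cong (gH *_) (closedForm-⊖-high (k ∸ highAscent r) hc 1≤ec)) (shuffle gH x ML _ WH)
        where
        shuffle : ∀ g x l w W → g * (x * (l * w * W)) ≡ g * (x * (l * W)) * w
        shuffle = solve-∀

  closedForm-absent : ∀ {m} (ρ : Fin m → Role) e k → e c₀ ≢ # root ρ → closedForm ρ e k ≡ 0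
  closedForm-absent ρ e k e≢ =
    cong (λ b → [ b ] * (ML ρ e * MH ρ e * ways (# big ρ) (# small ρ) (S ρ e) (T ρ e) k))
         (⌊⌋-false (e c₀ ≟ℕ # root ρ) e≢)

  closedForm-step : ∀ {m} r (ρ : Fin m → Role) e k →
    ∑[ c < B ] (if admits (allowed r) (ascent r) e k c then closedForm ρ (e ⊖ c) (k ∸ ascent r c) else 0)
    ≡ closedForm (r ∷ᵛ ρ) e k
  closedForm-step root  ρ e k = step-root ρ e k
  closedForm-step big   ρ e k =
    trans (step-leaf ρ e big (λ ()) k)
          (cong (λ w → [ ⌊ e c₀ ≟ℕ # root ρ ⌋ ] * (ML ρ e * MH ρ e * w))
                (trans (cong (_+ t₊ * (k₊ * ways P Q s (t ∸ 1) (k ∸ 1))) (cong (s₊ *_) (*-identityˡ _)))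
                       (sym (ways-big P Q s t k))))
    where
    P Q s t s₊ t₊ k₊ : ℕ
    P  = # big ρ
    Q  = # small ρ
    s  = S ρ e
    t  = T ρ e
    s₊ = [ ⌊ 1 ≤? s ⌋ ]
    t₊ = [ ⌊ 1 ≤? t ⌋ ]
    k₊ = [ ⌊ 1 ≤? k ⌋ ]
  closedForm-step small ρ e k =
    trans (step-leaf ρ e small (λ ()) k)
          (cong (λ w → [ ⌊ e c₀ ≟ℕ # root ρ ⌋ ] * (ML ρ e * MH ρ e * w))
                (trans (cong (s₊ * (k₊ * ways P Q (s ∸ 1) t (k ∸ 1)) +_) (cong (t₊ *_) (*-identityˡ _)))
                       (sym (ways-small P Q s t k))))
    where
    P Q s t s₊ t₊ k₊ : ℕ
    P  = # big ρ
    Q  = # small ρ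
    s  = S ρ e
    t  = T ρ e
    s₊ = [ ⌊ 1 ≤? s ⌋ ]
    t₊ = [ ⌊ 1 ≤? t ⌋ ]
    k₊ = [ ⌊ 1 ≤? k ⌋ ]

  count-closedForm : ∀ m (ρ : Fin m → Role) e k →
                     count m (λ v → allowed (ρ v)) (λ v → ascent (ρ v)) e k ≡ closedForm ρ e k
  count-closedForm zero ρ e k = begin
    count 0 (λ v → allowed (ρ v)) (λ v → ascent (ρ v)) e k
      ≡⟨ count-zero (λ v → allowed (ρ v)) (λ v → ascent (ρ v)) e k ⟩
    [ every (λ c → ⌊ 0 ≟ℕ e c ⌋) ∧ ⌊ 0 ≟ℕ k ⌋ ]
      ≡⟨ cong (λ b → [ b ∧ ⌊ 0 ≟ℕ k ⌋ ]) (trans (every-zero e) (cong (λ n → ⌊ n ≟ℕ 0 ⌋) (∑-by-side e))) ⟩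
    [ ⌊ e c₀ + (S ρ e + T ρ e) ≟ℕ 0 ⌋ ∧ ⌊ 0 ≟ℕ k ⌋ ]
      ≡⟨ empty (e c₀) (S ρ e) (T ρ e) k refl refl ⟩
    closedForm ρ e k ∎
    where
    empty : ∀ x s t k → s ≡ S ρ e → t ≡ T ρ e →
            [ ⌊ x + (s + t) ≟ℕ 0 ⌋ ∧ ⌊ 0 ≟ℕ k ⌋ ]
            ≡ [ ⌊ x ≟ℕ 0 ⌋ ] * (words low s e * words high t e * ways 0 0 s t k)
    empty (suc x) s       t       k       _   _   = refl
    empty zero    (suc s) t       k       _   _   =
      sym (trans (+-identityʳ _) (*-zeroʳ (words low (suc s) e * words high t e)))
    empty zero    zero    (suc t) k       _   _   =
      sym (trans (+-identityʳ _) (*-zeroʳ (words low 0 e * words high (suc t) e)))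
    empty zero    zero    zero    zero    S≡0 T≡0 rewrite sym S≡0 | sym T≡0 = refl
    empty zero    zero    zero    (suc k) S≡0 T≡0 rewrite sym S≡0 | sym T≡0 = refl
  count-closedForm (suc m) ρ e k = begin
    count (suc m) (λ v → allowed (ρ v)) (λ v → ascent (ρ v)) e k
      ≡⟨ count-suc (λ v → allowed (ρ v)) (λ v → ascent (ρ v)) e k ⟩
    ∑[ c < B ] (if admits (allowed r) (ascent r) e k c
                then count m (λ v → allowed (ρ′ v)) (λ v → ascent (ρ′ v)) (e ⊖ c) (k ∸ ascent r c) else 0)
      ≡⟨ ∑-cong (λ c → cong (if admits (allowed r) (ascent r) e k c then_else 0)
                            (count-closedForm m ρ′ (e ⊖ c) (k ∸ ascent r c))) ⟩
    ∑[ c < B ] (if admits (allowed r) (ascent r) e k c then closedForm ρ′ (e ⊖ c) (k ∸ ascent r c) else 0)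
      ≡⟨ closedForm-step r ρ′ e k ⟩
    closedForm ρ e k ∎
    where
    r : Role
    r = ρ fzero
    ρ′ : Fin m → Role
    ρ′ v = ρ (fsuc v)


-- The paper's inner sum over j, with P = n-r, Q = r-1, L = L_{α_i} and R = R_{α_i}.
innerSum : ℕ → ℕ → ℕ → ℕ → ℕ → ℕ
innerSum P Q L R k =
  sum (map (λ j → if ⌊ 2 * j + ∣ P - L ∣ ≟ℕ k ⌋ then (P C (P ⊓ L ∸ j)) * (Q C (Q ⊓ R ∸ j)) else 0)
           (upTo (suc ((P ⊓ L) ⊓ (Q ⊓ R)))))

2*-+-injective : ∀ w {x y} → 2 * x + w ≡ 2 * y + w → x ≡ y
2*-+-injective w eq = *-cancelˡ-≡ _ _ 2 (+-cancelʳ-≡ w _ _ eq)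

-- For L ≤ P the paper's j counts the small leaves below the root colour, for L > P the big
-- leaves above it.
belowTerm : ℕ → ℕ → ℕ → ℕ → ℕ
belowTerm L w Q j = ((L + w) C (L ∸ j)) * (Q C (Q ∸ j))

innerSum-below : ∀ L w Q k →
  innerSum (L + w) Q L (w + Q) k ≡ sumWhere (suc (L ⊓ Q)) (λ j → 2 * j + w) k (belowTerm L w Q)
innerSum-below L w Q k
  rewrite trans (∣-∣-comm (L + w) L) (∣m-m+n∣≡n L w)
        | m≥n⇒m⊓n≡n (m≤m+n L w)
        | m≤n⇒m⊓n≡m (m≤n+m Q w)
  = sum-map-applyUpTo (suc (L ⊓ Q)) (λ j → j) _

splits-below : ∀ L w Q k →
  splits (L + w) Q L k ≡ sumWhere (suc (L ⊓ Q)) (λ j → 2 * j + w) k (belowTerm L w Q)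
splits-below L w Q k with gap? k (L + (L + w))
... | no ∄a = trans (splits-none (L + w) Q L k (λ a eq → ∄a (a , eq)))
                    (sym (sumWhere-none (suc (L ⊓ Q)) (λ j → 2 * j + w) k (belowTerm L w Q) no-j))
  where
  no-j : ∀ j → j < suc (L ⊓ Q) → 2 * j + w ≢ k
  no-j j j<1+L⊓Q 2j+w≡k with m≤n⇒∃[o]m+o≡n (≤-trans (≤-pred j<1+L⊓Q) (m⊓n≤m L Q))
  ... | u , refl = ∄a (u , trans (cong (_+ 2 * u) (sym 2j+w≡k)) (regroup j u w))
    where
    regroup : ∀ j u w → 2 * j + w + 2 * u ≡ (j + u) + ((j + u) + w)
    regroup = solve-∀
... | yes (a , k+2a≡) with a ≤? L
...   | no a≰L = trans (splits-at (L + w) Q L k a k+2a≡)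
                       (trans (cong (λ b → [ b ] * ((L + w) C a) * (Q C (L ∸ a))) (⌊⌋-false (a ≤? L) a≰L))
                              (sym (sumWhere-none (suc (L ⊓ Q)) (λ j → 2 * j + w) k (belowTerm L w Q) no-j)))
  where
  no-j : ∀ j → j < suc (L ⊓ Q) → 2 * j + w ≢ k
  no-j j _ 2j+w≡k = a≰L (subst (a ≤_) j+a≡L (m≤n+m a j))
    where
    regroup : ∀ j a w → 2 * (j + a) + w ≡ 2 * j + w + 2 * a
    regroup = solve-∀
    regroup′ : ∀ L w → L + (L + w) ≡ 2 * L + w
    regroup′ = solve-∀
    j+a≡L : j + a ≡ L
    j+a≡L = 2*-+-injective w (trans (regroup j a w) (trans (cong (_+ 2 * a) 2j+w≡k) (trans k+2a≡ (regroup′ L w))))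
...   | yes a≤L with m≤n⇒∃[o]m+o≡n a≤L
...     | u , refl = begin
  splits (a + u + w) Q (a + u) k                      ≡⟨ splits-at (a + u + w) Q (a + u) k a k+2a≡ ⟩
  [ ⌊ a ≤? a + u ⌋ ] * ((a + u + w) C a) * (Q C (a + u ∸ a))
    ≡⟨ cong₂ (λ b x → [ b ] * ((a + u + w) C a) * (Q C x)) (⌊⌋-true (a ≤? a + u) a≤L) (m+n∸m≡n a u) ⟩
  1 * ((a + u + w) C a) * (Q C u)                     ≡⟨ cong (_* (Q C u)) (*-identityˡ ((a + u + w) C a)) ⟩
  ((a + u + w) C a) * (Q C u)                         ≡⟨ at-u (u ≤? Q) ⟩
  sumWhere (suc ((a + u) ⊓ Q)) (λ j → 2 * j + w) k (belowTerm (a + u) w Q) ∎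
  where
  2u+w≡k : 2 * u + w ≡ k
  2u+w≡k = +-cancelʳ-≡ (2 * a) _ _ (trans (regroup a u w) (sym k+2a≡))
    where
    regroup : ∀ a u w → 2 * u + w + 2 * a ≡ (a + u) + ((a + u) + w)
    regroup = solve-∀
  at-u : Dec (u ≤ Q) →
         ((a + u + w) C a) * (Q C u) ≡ sumWhere (suc ((a + u) ⊓ Q)) (λ j → 2 * j + w) k (belowTerm (a + u) w Q)
  at-u (yes u≤Q) = sym (trans
    (sumWhere-unique (suc ((a + u) ⊓ Q)) (λ j → 2 * j + w) k (belowTerm (a + u) w Q)
                     (2*-+-injective w) u 2u+w≡k (λ u>a+u⊓Q → ⊥-elim (<⇒≱ u>a+u⊓Q (⊓-glb (m≤n+m u a) u≤Q))))
    (cong₂ (λ x y → ((a + u + w) C x) * y) (m+n∸n≡m a u) (sym (nCk≡nC[n∸k] u≤Q))))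
  at-u (no u≰Q) = begin
    ((a + u + w) C a) * (Q C u)  ≡⟨ cong (((a + u + w) C a) *_) (k>n⇒nCk≡0 (≰⇒> u≰Q)) ⟩
    ((a + u + w) C a) * 0        ≡⟨ *-zeroʳ ((a + u + w) C a) ⟩
    0                            ≡⟨ sumWhere-none (suc ((a + u) ⊓ Q)) (λ j → 2 * j + w) k (belowTerm (a + u) w Q) no-j ⟨
    sumWhere (suc ((a + u) ⊓ Q)) (λ j → 2 * j + w) k (belowTerm (a + u) w Q) ∎
    where
    no-j : ∀ j → j < suc ((a + u) ⊓ Q) → 2 * j + w ≢ k
    no-j j j<1+a+u⊓Q 2j+w≡k = u≰Q (subst (_≤ Q) (2*-+-injective w (trans 2j+w≡k (sym 2u+w≡k)))
                                               (≤-trans (≤-pred j<1+a+u⊓Q) (m⊓n≤n (a + u) Q)))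

aboveTerm : ℕ → ℕ → ℕ → ℕ → ℕ
aboveTerm P R w j = (P C (P ∸ j)) * (suc (w + R) C (R ∸ j))

innerSum-above : ∀ P R w k →
  innerSum P (suc (w + R)) (suc (P + w)) R k
  ≡ sumWhere (suc (P ⊓ R)) (λ j → 2 * j + suc w) k (aboveTerm P R w)
innerSum-above P R w k
  rewrite trans (cong (λ x → ∣ P - x ∣) (sym (+-suc P w))) (∣m-m+n∣≡n P (suc w))
        | m≤n⇒m⊓n≡m (≤-trans (m≤m+n P w) (n≤1+n (P + w)))
        | m≥n⇒m⊓n≡n (≤-trans (m≤n+m R w) (n≤1+n (w + R)))
  = sum-map-applyUpTo (suc (P ⊓ R)) (λ j → j) _

splits-above : ∀ P R w k →
  splits P (suc (w + R)) (suc (P + w)) k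
  ≡ sumWhere (suc (P ⊓ R)) (λ j → 2 * j + suc w) k (aboveTerm P R w)
splits-above P R w k with gap? k (suc (P + w) + P)
... | no ∄a = trans (splits-none P (suc (w + R)) (suc (P + w)) k (λ a eq → ∄a (a , eq)))
                    (sym (sumWhere-none (suc (P ⊓ R)) (λ j → 2 * j + suc w) k (aboveTerm P R w) no-j))
  where
  no-j : ∀ j → j < suc (P ⊓ R) → 2 * j + suc w ≢ k
  no-j j j<1+P⊓R 2j+1+w≡k with m≤n⇒∃[o]m+o≡n (≤-trans (≤-pred j<1+P⊓R) (m⊓n≤m P R))
  ... | u , refl = ∄a (u , trans (cong (_+ 2 * u) (sym 2j+1+w≡k)) (regroup j u w))
    where
    regroup : ∀ j u w → 2 * j + suc w + 2 * u ≡ suc ((j + u) + w) + (j + u)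
    regroup = solve-∀
... | yes (a , k+2a≡) with a ≤? P
...   | no a≰P = trans (splits-at P (suc (w + R)) (suc (P + w)) k a k+2a≡)
                       (trans (pick-beyond P (suc (w + R)) (suc (P + w)) a (≰⇒> a≰P))
                              (sym (sumWhere-none (suc (P ⊓ R)) (λ j → 2 * j + suc w) k (aboveTerm P R w) no-j)))
  where
  no-j : ∀ j → j < suc (P ⊓ R) → 2 * j + suc w ≢ k
  no-j j _ 2j+1+w≡k = a≰P (subst (a ≤_) j+a≡P (m≤n+m a j))
    where
    regroup : ∀ j a w → 2 * (j + a) + suc w ≡ 2 * j + suc w + 2 * a
    regroup = solve-∀
    regroup′ : ∀ P w → suc (P + w) + P ≡ 2 * P + suc w
    regroup′ = solve-∀
    j+a≡P : j + a ≡ P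
    j+a≡P = 2*-+-injective (suc w)
              (trans (regroup j a w) (trans (cong (_+ 2 * a) 2j+1+w≡k) (trans k+2a≡ (regroup′ P w))))
...   | yes a≤P with m≤n⇒∃[o]m+o≡n a≤P
...     | u , refl = begin
  splits (a + u) (suc (w + R)) (suc (a + u + w)) k
    ≡⟨ splits-at (a + u) (suc (w + R)) (suc (a + u + w)) k a k+2a≡ ⟩
  [ ⌊ a ≤? suc (a + u + w) ⌋ ] * ((a + u) C a) * (suc (w + R) C (suc (a + u + w) ∸ a))
    ≡⟨ cong₂ (λ b x → [ b ] * ((a + u) C a) * (suc (w + R) C x))
             (⌊⌋-true (a ≤? suc (a + u + w)) a≤1+a+u+w)
             1+a+u+w∸a ⟩
  1 * ((a + u) C a) * (suc (w + R) C suc (u + w))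
    ≡⟨ cong (_* (suc (w + R) C suc (u + w))) (*-identityˡ ((a + u) C a)) ⟩
  ((a + u) C a) * (suc (w + R) C suc (u + w))
    ≡⟨ at-u (u ≤? R) ⟩
  sumWhere (suc ((a + u) ⊓ R)) (λ j → 2 * j + suc w) k (aboveTerm (a + u) R w) ∎
  where
  a≤1+a+u+w : a ≤ suc (a + u + w)
  a≤1+a+u+w = ≤-trans (m≤m+n a u) (≤-trans (m≤m+n (a + u) w) (n≤1+n _))
  1+a+u+w∸a : suc (a + u + w) ∸ a ≡ suc (u + w)
  1+a+u+w∸a = trans (cong (_∸ a) (regroup a u w)) (m+n∸m≡n a (suc (u + w)))
    where
    regroup : ∀ a u w → suc (a + u + w) ≡ a + suc (u + w)
    regroup = solve-∀
  2u+1+w≡k : 2 * u + suc w ≡ k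
  2u+1+w≡k = +-cancelʳ-≡ (2 * a) _ _ (trans (regroup a u w) (sym k+2a≡))
    where
    regroup : ∀ a u w → 2 * u + suc w + 2 * a ≡ suc ((a + u) + w) + (a + u)
    regroup = solve-∀
  at-u : Dec (u ≤ R) → ((a + u) C a) * (suc (w + R) C suc (u + w))
                       ≡ sumWhere (suc ((a + u) ⊓ R)) (λ j → 2 * j + suc w) k (aboveTerm (a + u) R w)
  at-u (yes u≤R) with m≤n⇒∃[o]m+o≡n u≤R
  ... | v , refl = sym (trans
    (sumWhere-unique (suc ((a + u) ⊓ (u + v))) (λ j → 2 * j + suc w) k (aboveTerm (a + u) (u + v) w)
                     (2*-+-injective (suc w)) u 2u+1+w≡k
                     (λ u>a+u⊓R → ⊥-elim (<⇒≱ u>a+u⊓R (⊓-glb (m≤n+m u a) (m≤m+n u v)))))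
    (cong₂ (λ x y → ((a + u) C x) * y) (m+n∸n≡m a u)
           (trans (cong (suc (w + (u + v)) C_) (m+n∸m≡n u v)) (sym complement))))
    where
    complement : suc (w + (u + v)) C suc (u + w) ≡ suc (w + (u + v)) C v
    complement =
      trans (nCk≡nC[n∸k] (subst (suc (u + w) ≤_) (sym (regroup w u v)) (m≤m+n _ v)))
            (cong (suc (w + (u + v)) C_) (trans (cong (_∸ suc (u + w)) (regroup w u v)) (m+n∸m≡n (suc (u + w)) v)))
      where
      regroup : ∀ w u v → suc (w + (u + v)) ≡ suc (u + w) + v
      regroup = solve-∀
  at-u (no u≰R) = begin
    ((a + u) C a) * (suc (w + R) C suc (u + w))  ≡⟨ cong (((a + u) C a) *_) (k>n⇒nCk≡0 1+w+R<1+u+w) ⟩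
    ((a + u) C a) * 0                            ≡⟨ *-zeroʳ ((a + u) C a) ⟩
    0                                            ≡⟨ sumWhere-none (suc ((a + u) ⊓ R)) (λ j → 2 * j + suc w) k
                                                                  (aboveTerm (a + u) R w) no-j ⟨
    sumWhere (suc ((a + u) ⊓ R)) (λ j → 2 * j + suc w) k (aboveTerm (a + u) R w) ∎
    where
    1+w+R<1+u+w : suc (w + R) < suc (u + w)
    1+w+R<1+u+w = s≤s (subst₂ _≤_ (+-suc w R) (+-comm w u) (+-monoʳ-≤ w (≰⇒> u≰R)))
    no-j : ∀ j → j < suc ((a + u) ⊓ R) → 2 * j + suc w ≢ k
    no-j j j<1+a+u⊓R 2j+1+w≡k = u≰R (subst (_≤ R) (2*-+-injective (suc w) (trans 2j+1+w≡k (sym 2u+1+w≡k)))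
                                                 (≤-trans (≤-pred j<1+a+u⊓R) (m⊓n≤n (a + u) R)))

splits≡innerSum : ∀ P Q L R k → P + Q ≡ L + R → splits P Q L k ≡ innerSum P Q L R k
splits≡innerSum P Q L R k P+Q≡L+R with L ≤? P
... | yes L≤P with m≤n⇒∃[o]m+o≡n L≤P
...   | w , refl with +-cancelˡ-≡ L (w + Q) R (trans (sym (+-assoc L w Q)) P+Q≡L+R)
...     | refl = trans (splits-below L w Q k) (sym (innerSum-below L w Q k))
splits≡innerSum P Q L R k P+Q≡L+R | no L≰P with m≤n⇒∃[o]m+o≡n (≰⇒> L≰P)
...   | w , refl with +-cancelˡ-≡ P Q (suc (w + R)) (trans P+Q≡L+R (trans (+-assoc (suc P) w R) (sym (+-suc P (w + R)))))
...     | refl = trans (splits-above P R w k) (sym (innerSum-above P R w k))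


count-above : ∀ n t → ∑[ u < n ] [ ⌊ t <? toℕ u ⌋ ] ≡ n ∸ suc t
count-above zero    t       = refl
count-above (suc n) zero    = ones n
  where
  ones : ∀ n → ∑[ u < n ] 1 ≡ n
  ones zero    = refl
  ones (suc n) = cong suc (ones n)
count-above (suc n) (suc t) = begin
  ∑[ u < n ] [ ⌊ suc t <? suc (toℕ u) ⌋ ]  ≡⟨ ∑-cong {n} (λ u → cong [_] (⌊suc<?suc⌋ t (toℕ u))) ⟩
  ∑[ u < n ] [ ⌊ t <? toℕ u ⌋ ]            ≡⟨ count-above n t ⟩
  n ∸ suc t                                 ∎

count-below : ∀ n t → t ≤ n → ∑[ u < n ] [ ⌊ toℕ u <? t ⌋ ] ≡ t
count-below n       zero    _         = sum-replicate-zero n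
count-below (suc n) (suc t) (s≤s t≤n) = begin
  1 + ∑[ u < n ] [ ⌊ suc (toℕ u) <? suc t ⌋ ]  ≡⟨ cong suc (∑-cong {n} (λ u → cong [_] (⌊suc<?suc⌋ (toℕ u) t))) ⟩
  1 + ∑[ u < n ] [ ⌊ toℕ u <? t ⌋ ]            ≡⟨ cong suc (count-below n t t≤n) ⟩
  suc t                                         ∎

module OnStar (n : ℕ) (v₀ : Fin n) (L : Fin n ↔ Fin n) where
  open Star n v₀ L

  role : Fin n → Role
  role v = if isEdgeTo v then (if ⌊ lab v₀ <? lab v ⌋ then big else small) else root

  lab-injective : ∀ {v w} → lab v ≡ lab w → v ≡ w
  lab-injective {v} {w} eq = begin
    v                                  ≡⟨ Inverse.strictlyInverseʳ L v ⟨
    Inverse.from L (Inverse.to L v)    ≡⟨ cong (Inverse.from L) (toℕ-injective eq) ⟩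
    Inverse.from L (Inverse.to L w)    ≡⟨ Inverse.strictlyInverseʳ L w ⟩
    w                                  ∎

  role-v₀ : role v₀ ≡ root
  role-v₀ = cong (if_then (if ⌊ lab v₀ <? lab v₀ ⌋ then big else small) else root)
                 (⌊⌋-false (¬? (v₀ ≟ᶠ v₀)) (λ v₀≢v₀ → v₀≢v₀ refl))

  role-leaf : ∀ {v} → v ≢ v₀ → role v ≡ (if ⌊ lab v₀ <? lab v ⌋ then big else small)
  role-leaf {v} v≢v₀ = cong (if_then (if ⌊ lab v₀ <? lab v ⌋ then big else small) else root)
                            (⌊⌋-true (¬? (v ≟ᶠ v₀)) v≢v₀)

  below-v₀ : ∀ {v} → v ≢ v₀ → ⌊ lab v₀ <? lab v ⌋ ≡ false → ⌊ lab v <? lab v₀ ⌋ ≡ true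
  below-v₀ {v} v≢v₀ ¬above with lab v₀ <? lab v
  ... | no v₀≮v = ⌊⌋-true (lab v <? lab v₀) (≤∧≢⇒< (≮⇒≥ v₀≮v) (λ eq → v≢v₀ (lab-injective eq)))

  module _ {B} (κ : Fin n → Fin B) where
    open RootColour (κ v₀)

    proper≡every-allowed : proper κ ≡ every (λ v → allowed (role v) (κ v))
    proper≡every-allowed =
      trans (and-map-tabulate (λ v → v) (λ v → if isEdgeTo v then ⌊ ¬? (col κ v ≟ℕ col κ v₀) ⌋ else true))
            (every-cong {n} at)
      where
      at : ∀ v → (if isEdgeTo v then ⌊ ¬? (col κ v ≟ℕ col κ v₀) ⌋ else true) ≡ allowed (role v) (κ v)
      at v with v ≟ᶠ v₀
      ... | yes refl = sym (⌊≟ᶠ⌋-refl (κ v₀))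
      ... | no _ with ⌊ lab v₀ <? lab v ⌋
      ...   | true  = refl
      ...   | false = refl

    hasContent≡every-content : ∀ e → hasContent κ e ≡ every (λ c → ⌊ content κ c ≟ℕ e c ⌋)
    hasContent≡every-content e =
      trans (and-map-tabulate (λ c → c) (λ c → ⌊ fibre κ c ≟ℕ e c ⌋))
            (every-cong {B} (λ c → cong (λ x → ⌊ x ≟ℕ e c ⌋) (countB-allFin (λ v → ⌊ κ v ≟ᶠ c ⌋))))

    asc≡∑-ascent : asc κ ≡ ∑[ v < n ] ascent (role v) (κ v)
    asc≡∑-ascent = trans (countB-allFin (ascentAt κ)) (∑-cong {n} at)
      where
      at : ∀ v → [ ascentAt κ v ] ≡ ascent (role v) (κ v)
      at v with v ≟ᶠ v₀
      ... | yes refl = refl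
      ... | no v≢v₀ with lab v₀ <? lab v
      ...   | yes v₀<v rewrite ⌊⌋-false (lab v <? lab v₀) (<-asym v₀<v) = cong [_] (∨-identityʳ _)
      ...   | no v₀≮v  rewrite below-v₀ v≢v₀ (⌊⌋-false (lab v₀ <? lab v) v₀≮v) = refl

  chiCoeff≡∑-count : ∀ B e k → chiCoeff B e k
    ≡ ∑[ c₀ < B ] count n (λ v → RootColour.allowed c₀ (role v)) (λ v → RootColour.ascent c₀ (role v)) e k
  chiCoeff≡∑-count B e k =
    trans (cong sum (map-cong by-root-colour (allFuns n B)))
          (sum-map-∑ (λ κ c₀ → [ admissible-at c₀ κ ]) (allFuns n B))
    where
    admissible-at : Fin B → (Fin n → Fin B) → Bool
    admissible-at c₀ = admissible (λ v → RootColour.allowed c₀ (role v)) (λ v → RootColour.ascent c₀ (role v)) e k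
    by-root-colour : ∀ κ → [ proper κ ∧ hasContent κ e ∧ ⌊ asc κ ≟ℕ k ⌋ ] ≡ ∑[ c₀ < B ] [ admissible-at c₀ κ ]
    by-root-colour κ = sym (begin
      ∑[ c₀ < B ] [ admissible-at c₀ κ ]
        ≡⟨ ∑-cong {B} only-κv₀ ⟩
      ∑[ c₀ < B ] (if ⌊ κ v₀ ≟ᶠ c₀ ⌋ then [ admissible-at c₀ κ ] else 0)
        ≡⟨ ∑-delta (κ v₀) (λ c₀ → [ admissible-at c₀ κ ]) ⟩
      [ admissible-at (κ v₀) κ ]
        ≡⟨ cong [_] (cong₂ _∧_ (sym (proper≡every-allowed κ))
                               (cong₂ _∧_ (sym (hasContent≡every-content κ e))
                                          (cong (λ x → ⌊ x ≟ℕ k ⌋) (sym (asc≡∑-ascent κ))))) ⟩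
      [ proper κ ∧ hasContent κ e ∧ ⌊ asc κ ≟ℕ k ⌋ ] ∎)
      where
      only-κv₀ : ∀ c₀ → [ admissible-at c₀ κ ] ≡ (if ⌊ κ v₀ ≟ᶠ c₀ ⌋ then [ admissible-at c₀ κ ] else 0)
      only-κv₀ c₀ with κ v₀ ≟ᶠ c₀
      ... | yes _     = refl
      ... | no κv₀≢c₀ = cong (λ b → [ b ∧ rest ]) (every-false _ v₀
          (trans (cong (λ r → RootColour.allowed c₀ r (κ v₀)) role-v₀) (⌊⌋-false (c₀ ≟ᶠ κ v₀) (≢-sym κv₀≢c₀))))
        where
        rest : Bool
        rest = every (λ c → ⌊ content κ c ≟ℕ e c ⌋) ∧ ⌊ ∑[ v < n ] RootColour.ascent c₀ (role v) (κ v) ≟ℕ k ⌋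

  #root-role : # root role ≡ 1
  #root-role = trans (∑-cong {n} at) (∑-delta v₀ (λ _ → 1))
    where
    at : ∀ v → [ role v ≡ᴿ root ] ≡ (if ⌊ v₀ ≟ᶠ v ⌋ then 1 else 0)
    at v with v₀ ≟ᶠ v
    ... | yes refl = cong (λ r → [ r ≡ᴿ root ]) role-v₀
    ... | no v₀≢v rewrite role-leaf (≢-sym v₀≢v) with ⌊ lab v₀ <? lab v ⌋
    ...   | true  = refl
    ...   | false = refl

  #big-role : # big role ≡ n ∸ suc (lab v₀)
  #big-role = begin
    ∑[ v < n ] [ role v ≡ᴿ big ]        ≡⟨ ∑-cong {n} at ⟩
    ∑[ v < n ] [ ⌊ lab v₀ <? lab v ⌋ ]  ≡⟨ ∑-permute (λ u → [ ⌊ lab v₀ <? toℕ u ⌋ ]) L ⟨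
    ∑[ u < n ] [ ⌊ lab v₀ <? toℕ u ⌋ ]  ≡⟨ count-above n (lab v₀) ⟩
    n ∸ suc (lab v₀)                    ∎
    where
    at : ∀ v → [ role v ≡ᴿ big ] ≡ [ ⌊ lab v₀ <? lab v ⌋ ]
    at v with v ≟ᶠ v₀
    ... | yes refl = cong [_] (sym (⌊⌋-false (lab v₀ <? lab v₀) (n≮n _)))
    ... | no _ with ⌊ lab v₀ <? lab v ⌋
    ...   | true  = refl
    ...   | false = refl

  #small-role : # small role ≡ lab v₀
  #small-role = begin
    ∑[ v < n ] [ role v ≡ᴿ small ]      ≡⟨ ∑-cong {n} at ⟩
    ∑[ v < n ] [ ⌊ lab v <? lab v₀ ⌋ ]  ≡⟨ ∑-permute (λ u → [ ⌊ toℕ u <? lab v₀ ⌋ ]) L ⟨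
    ∑[ u < n ] [ ⌊ toℕ u <? lab v₀ ⌋ ]  ≡⟨ count-below n (lab v₀) (<⇒≤ (toℕ<n _)) ⟩
    lab v₀                              ∎
    where
    at : ∀ v → [ role v ≡ᴿ small ] ≡ [ ⌊ lab v <? lab v₀ ⌋ ]
    at v with v ≟ᶠ v₀
    ... | yes refl = cong [_] (sym (⌊⌋-false (lab v₀ <? lab v₀) (n≮n _)))
    ... | no v≢v₀ with lab v₀ <? lab v
    ...   | yes v₀<v rewrite ⌊⌋-false (lab v <? lab v₀) (<-asym v₀<v) = refl
    ...   | no v₀≮v  rewrite below-v₀ v≢v₀ (⌊⌋-false (lab v₀ <? lab v) v₀≮v) = refl

  roles-total : suc (# big role + # small role) ≡ n
  roles-total = begin
    suc (# big role + # small role)  ≡⟨ cong suc (cong₂ _+_ #big-role #small-role) ⟩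
    suc (n ∸ suc (lab v₀) + lab v₀)  ≡⟨ +-suc (n ∸ suc (lab v₀)) (lab v₀) ⟨
    n ∸ suc (lab v₀) + suc (lab v₀)  ≡⟨ m∸n+n≡m (toℕ<n (Inverse.to L v₀)) ⟩
    n                                ∎

mult-unique : ∀ β M → M * product (map _! β) ≡ sum β ! → mult β ≡ M
mult-unique β M M*∏≡ = trans (cong (λ x → (x / product (map _! β)) {{prod!≢0 β}}) (sym M*∏≡))
                             (m*n/n≡m M (product (map _! β)) {{prod!≢0 β}})

module ColourVector (α : List ℕ) {B} (idx : Fin (length α) → Fin B)
                    (idx-mono : ∀ a b → a <ᶠ b → idx a <ᶠ idx b)
                    (e : Fin B → ℕ) (e∘idx : ∀ j → e (idx j) ≡ lookup α j)
                    (e-off : ∀ c → (∀ j → idx j ≢ c) → e c ≡ 0) where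

  idx-injective : ∀ {i j} → idx i ≡ idx j → i ≡ j
  idx-injective {i} {j} eq with <-cmp (toℕ i) (toℕ j)
  ... | tri< i<j _ _ = ⊥-elim (<-irrefl (cong toℕ eq) (idx-mono i j i<j))
  ... | tri≈ _ i≡j _ = toℕ-injective i≡j
  ... | tri> _ _ j<i = ⊥-elim (<-irrefl (cong toℕ (sym eq)) (idx-mono j i j<i))

  idx-< : ∀ i j → ⌊ toℕ (idx i) <? toℕ (idx j) ⌋ ≡ ⌊ toℕ i <? toℕ j ⌋
  idx-< i j = ⌊⌋-⇔ (toℕ (idx i) <? toℕ (idx j)) (toℕ i <? toℕ j) reflect (idx-mono i j)
    where
    reflect : toℕ (idx i) < toℕ (idx j) → toℕ i < toℕ j
    reflect idx-i<idx-j with <-cmp (toℕ i) (toℕ j)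
    ... | tri< i<j _ _ = i<j
    ... | tri≈ _ i≡j _ = ⊥-elim (<-irrefl (cong (λ x → toℕ (idx x)) (toℕ-injective i≡j)) idx-i<idx-j)
    ... | tri> _ _ j<i = ⊥-elim (<-asym idx-i<idx-j (idx-mono j i j<i))

  private
    module ∑ = FinFold.Supported +-0-isCommutativeMonoid α idx idx-injective idx-< e e∘idx e-off (λ x → x) refl
    module ∏ = FinFold.Supported *-1-isCommutativeMonoid α idx idx-injective idx-< e e∘idx e-off _! refl

  module _ (i : Fin (length α)) where
    open RootColour (idx i)

    before after : List ℕ
    before = take (toℕ i) α
    after  = drop (suc (toℕ i)) α

    total-low : total low e ≡ sum before
    total-low = trans (∑.fold-before i) (cong sum (map-id before))

    total-high : total high e ≡ sum after
    total-high = trans (∑.fold-after i) (cong sum (map-id after))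

    words-low : words low (total low e) e ≡ mult before
    words-low = sym (mult-unique before _ (begin
      words low (total low e) e * product (map _! before)  ≡⟨ cong (words low (total low e) e *_) (∏.fold-before i) ⟨
      words low (total low e) e * ∏! low e                 ≡⟨ words-∏! low _ e refl ⟩
      total low e !                                         ≡⟨ cong _! total-low ⟩
      sum before !                                          ∎))

    words-high : words high (total high e) e ≡ mult after
    words-high = sym (mult-unique after _ (begin
      words high (total high e) e * product (map _! after)  ≡⟨ cong (words high (total high e) e *_) (∏.fold-after i) ⟨
      words high (total high e) e * ∏! high e               ≡⟨ words-∏! high _ e refl ⟩
      total high e !                                         ≡⟨ cong _! total-high ⟩
      sum after !                                            ∎))

    sum-split : lookup α i + (sum before + sum after) ≡ sum α
    sum-split = begin
      lookup α i + (sum before + sum after)     ≡⟨ cong₂ _+_ (e∘idx i) (cong₂ _+_ total-low total-high) ⟨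
      e (idx i) + (total low e + total high e)  ≡⟨ ∑-by-side e ⟨
      ∑[ c < B ] e c                            ≡⟨ ∑.fold-all ⟩
      sum (map (λ x → x) α)                     ≡⟨ cong sum (map-id α) ⟩
      sum α                                     ∎

    closedForm-at : ∀ {m} (ρ : Fin m → Role) → # root ρ ≡ 1 → suc (# big ρ + # small ρ) ≡ sum α → ∀ k →
      closedForm ρ e k ≡ (if ⌊ lookup α i ≟ℕ 1 ⌋
                          then mult after * mult before * innerSum (# big ρ) (# small ρ) (sum before) (sum after) k
                          else 0)
    closedForm-at ρ one-root sizes k with lookup α i ≟ℕ 1
    ... | no αᵢ≢1  = closedForm-absent ρ e k (λ eq → αᵢ≢1 (trans (sym (e∘idx i)) (trans eq one-root)))
    ... | yes αᵢ≡1 = begin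
      [ ⌊ e (idx i) ≟ℕ # root ρ ⌋ ] * (ML ρ e * MH ρ e * ([ ⌊ S ρ e + T ρ e ≟ℕ P + Q ⌋ ] * splits P Q (S ρ e) k))
        ≡⟨ cong₂ (λ b b′ → [ b ] * (ML ρ e * MH ρ e * ([ b′ ] * splits P Q (S ρ e) k)))
                 (⌊⌋-true (e (idx i) ≟ℕ # root ρ) (trans (e∘idx i) (trans αᵢ≡1 (sym one-root))))
                 (⌊⌋-true (S ρ e + T ρ e ≟ℕ P + Q) S+T≡P+Q) ⟩
      1 * (ML ρ e * MH ρ e * (1 * splits P Q (S ρ e) k))
        ≡⟨ regroup (ML ρ e) (MH ρ e) (splits P Q (S ρ e) k) ⟩
      MH ρ e * ML ρ e * splits P Q (S ρ e) k
        ≡⟨ cong₂ _*_ (cong₂ _*_ words-high words-low)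
                     (trans (splits≡innerSum P Q (S ρ e) (T ρ e) k (sym S+T≡P+Q))
                            (cong₂ (λ s t → innerSum P Q s t k) total-low total-high)) ⟩
      mult after * mult before * innerSum P Q (sum before) (sum after) k ∎
      where
      P Q : ℕ
      P = # big ρ
      Q = # small ρ
      regroup : ∀ x y z → 1 * (x * y * (1 * z)) ≡ y * x * z
      regroup = solve-∀
      S+T≡P+Q : S ρ e + T ρ e ≡ P + Q
      S+T≡P+Q = trans (cong₂ _+_ total-low total-high)
        (suc-injective (trans (cong (_+ (sum before + sum after)) (sym αᵢ≡1)) (trans sum-split (sym sizes))))

-- 1 ≤ r ≤ n follows from r being the root's label.
proposition4p2 : (n r : ℕ) → 2 ≤ n → 1 ≤ r → r ≤ n →
    (v0 : Fin n) (L : Fin n ↔ Fin n) → suc (toℕ (Inverse.to L v0)) ≡ r →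
    (α : List ℕ) → All (λ a → 1 ≤ a) α → sum α ≡ n →
    (B : ℕ) (idx : Fin (length α) → Fin B) →
    (∀ a b → a <ᶠ b → idx a <ᶠ idx b) →
    (e : Fin B → ℕ) → (∀ j → e (idx j) ≡ lookup α j) →
    (∀ c → (∀ j → idx j ≢ c) → e c ≡ 0) →
    (k : ℕ) → Star.chiCoeff n v0 L B e k ≡ Formula.rhsCoeff n r α k
proposition4p2 n r _ _ _ v₀ L refl α _ sum≡n B idx idx-mono e e∘idx e-off k = begin
  chiCoeff B e k
    ≡⟨ chiCoeff≡∑-count B e k ⟩
  ∑[ c < B ] count n (λ v → allowed c (role v)) (λ v → ascent c (role v)) e k
    ≡⟨ ∑-cong {B} (λ c → count-closedForm c n role e k) ⟩
  ∑[ c < B ] closedForm c role e k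
    ≡⟨ ∑-reindex idx idx-injective (λ c → closedForm c role e k) off-image ⟩
  ∑[ i < length α ] closedForm (idx i) role e k
    ≡⟨ ∑-cong {length α} at-part ⟩
  ∑[ i < length α ] part i
    ≡⟨ sum-map-tabulate (λ i → i) part ⟨
  rhsCoeff k ∎
  where
  open Star n v₀ L using (chiCoeff)
  open Formula n (suc (toℕ (Inverse.to L v₀))) α
  open OnStar n v₀ L
  open ColourVector α idx idx-mono e e∘idx e-off
  open RootColour using (allowed; ascent; closedForm; count-closedForm; closedForm-absent)
  part : Fin (length α) → ℕ
  part i = if ⌊ lookup α i ≟ℕ 1 ⌋ then mult (rcomp i) * mult (lcomp i) * innerCoeff i k else 0
  off-image : ∀ c → (∀ j → idx j ≢ c) → closedForm c role e k ≡ 0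
  off-image c off = closedForm-absent c role e k (λ eq → 0≢1+n (trans (sym (e-off c off)) (trans eq #root-role)))
  at-part : ∀ i → closedForm (idx i) role e k ≡ part i
  at-part i = trans (closedForm-at i role #root-role (trans roles-total (sym sum≡n)) k)
                    (cong₂ (λ P Q → if ⌊ lookup α i ≟ℕ 1 ⌋ then mult (rcomp i) * mult (lcomp i) * innerSum P Q (Lα i) (Rα i) k
                                    else 0)
                           #big-role #small-role)
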